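{- Let $n\ge4$, $1\le k\le\ell\le n-2$, and let $M=M_n[k,\ell]$. Then for every index $m$, $$h_m^*(P_M)=h_m^*\big(P_{M_n[1,\ell]}\big)+h_m^*\big(P_{M_n[1,n-k-1]}\big)-h_m^*\big(P_{U_{2,n}}\big),$$ i.e. the $h^*$-vector of $M_n[k,\ell]$ is determined by $h^*$-vectors of rank-$2$ Schubert matroids and of $U_{2,n}$.
   Context: To a $2$-subset $B\subseteq[n]$ associate the monotone lattice path from $(0,0)$ to $(n-2,2)$ whose $i$-th step is north iff $i\in B$. For such paths $U$ weakly above $L$, $M[U,L]$ is the rank-$2$ matroid on $[n]$ whose bases are the $2$-subsets whose paths lie between $U$ and $L$. For $1\le k\le\ell\le n-2$, $M_n[k,\ell]=M[U,L]$ with $U=\{1,n-\ell\}$ and $L=\{n-k+1,n\}$; $U_{2,n}=M_n[1,n-2]$ is the uniform matroid of rank $2$ on $[n]$. For a matroid $N$, $P_N=\mathrm{conv}\{e_B:B\text{ a basis of }N\}$. For a lattice polytope $P$ of dimension $d$, the $h^*$-vector is defined by $\sum_{t\ge0}\#(tP\cap\mathbb{Z}^n)z^t=\frac{\sum_i h_i^*z^i}{(1-z)^{d+1}}$ (with $h_i^*=0$ beyond the degree). -}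

module Defs where

open import Data.Bool using (Bool; true; false; if_then_else_; _∧_; _∨_; T)
open import Data.Nat as ℕ using (ℕ; zero; suc; _∸_; _≤ᵇ_; _≡ᵇ_)
open import Data.Nat.Combinatorics using (_C_)
open import Data.Fin using (Fin; toℕ)
open import Data.Integer as ℤ using (ℤ; +_)
open import Data.Rational as ℚ using (ℚ; 0ℚ; 1ℚ)
open import Data.List using (List; []; _∷_; map; concatMap; upTo; filterᵇ; length; foldr)
open import Data.Bool.ListAction using (and)
open import Data.List.Membership.Propositional using (_∈_)
open import Data.List.Relation.Unary.All using (All)
open import Data.List.Relation.Unary.Unique.Propositional using (Unique)
open import Data.Vec using (Vec; tabulate; replicate; zipWith)
open import Data.Product using (_×_; _,_; Σ; ∃)
open import Data.List.Relation.Binary.Subset.Propositional using (_⊆_)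
open import Function.Bundles using (_⇔_)
open import Relation.Binary.PropositionalEquality using (_≡_)

-- 2-subsets of [n] = {1,…,n}, represented as pairs (a , b) with 1 ≤ a < b ≤ n.

TwoSubset : Set
TwoSubset = ℕ × ℕ

pairs : ℕ → List TwoSubset
pairs n = concatMap (λ b → map (λ a → (suc a , suc b)) (upTo b)) (upTo n)

-- The lattice path of B: after t steps (0 ≤ t ≤ n) it is at height
-- #{ x ∈ B : x ≤ t } (it is at the point (t - height , height)).
height : TwoSubset → ℕ → ℕ
height (a , b) t = (if a ≤ᵇ t then 1 else 0) ℕ.+ (if b ≤ᵇ t then 1 else 0)

between : ℕ → TwoSubset → TwoSubset → TwoSubset → Bool
between n U L B =
  and (map (λ t → (height L t ≤ᵇ height B t) ∧ (height B t ≤ᵇ height U t)) (upTo (suc n)))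

basesLPM : ℕ → TwoSubset → TwoSubset → List TwoSubset
basesLPM n U L = filterᵇ (between n U L) (pairs n)

-- indicator vector e_B ∈ ℚ^n (coordinate i : Fin n corresponds to element toℕ i + 1)
indicator : (n : ℕ) → TwoSubset → Vec ℚ n
indicator n (a , b) =
  tabulate (λ i → if (suc (toℕ i) ≡ᵇ a) ∨ (suc (toℕ i) ≡ᵇ b) then 1ℚ else 0ℚ)

-- vertex list of the matroid polytope P_{M[U,L]} = conv { e_B : B basis }
polytopeLPM : (n : ℕ) → TwoSubset → TwoSubset → List (Vec ℚ n)
polytopeLPM n U L = map (indicator n) (basesLPM n U L)

-- M_n[k,ℓ] = M[U,L] with U = {1, n-ℓ}, L = {n-k, n}
-- (the context's "n-k+1" is off by one; with it
--  U_{2,n} = M_n[1,n-2] would fail, L = {n,n} not being a 2-subset)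
Mn : (n k ℓ : ℕ) → List (Vec ℚ n)
Mn n k ℓ = polytopeLPM n (1 , n ∸ ℓ) (n ∸ k , n)

U2 : (n : ℕ) → List (Vec ℚ n)
U2 n = Mn n 1 (n ∸ 2)

sumℚ : List ℚ → ℚ
sumℚ = foldr ℚ._+_ 0ℚ

-- Σ_j c_j v_j   (extra entries of the longer list are ignored;
-- lengths are required to agree wherever it is used)
lincomb : {n : ℕ} → List ℚ → List (Vec ℚ n) → Vec ℚ n
lincomb {n} (c ∷ cs) (v ∷ vs) = zipWith ℚ._+_ (Data.Vec.map (c ℚ.*_) v) (lincomb cs vs)
lincomb {n} _ _ = replicate n 0ℚ

toℚvec : {n : ℕ} → Vec ℤ n → Vec ℚ n
toℚvec = Data.Vec.map (λ z → z ℚ./ 1)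

InDilate : {n : ℕ} → List (Vec ℚ n) → ℕ → Vec ℤ n → Set
InDilate vs t x =
  Σ (List ℚ) λ c → (length c ≡ length vs) × All (0ℚ ℚ.≤_) c
    × (sumℚ c ≡ (+ t) ℚ./ 1) × (lincomb c vs ≡ toℚvec x)

IsEhrhart : {n : ℕ} → List (Vec ℚ n) → (ℕ → ℕ) → Set
IsEhrhart vs L = ∀ t → Σ (List (Vec ℤ _)) λ xs →
  Unique xs × (∀ x → (x ∈ xs) ⇔ InDilate vs t x) × (length xs ≡ L t)

AffIndep : {n : ℕ} → List (Vec ℚ n) → Set
AffIndep ps = ∀ (c : List ℚ) → length c ≡ length ps → sumℚ c ≡ 0ℚ →
  lincomb c ps ≡ replicate _ 0ℚ → All (_≡ 0ℚ) c

IsDim : {n : ℕ} → List (Vec ℚ n) → ℕ → Set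
IsDim vs d =
  (Σ (List (Vec ℚ _)) λ ps → (ps ⊆ vs) × AffIndep ps × (length ps ≡ suc d))
  × (∀ ps → ps ⊆ vs → AffIndep ps → length ps ℕ.≤ suc d)

-- h^*-vector: coefficient of z^m in (1 - z)^{d+1} · Σ_t L(t) z^t,
--   h*_m = Σ_{j=0}^{m} (-1)^j C(d+1, j) L(m - j).

sign : ℕ → ℤ
sign zero = + 1
sign (suc j) = ℤ.- sign j

sumℤ : List ℤ → ℤ
sumℤ = foldr ℤ._+_ (+ 0)

hstar : (d : ℕ) → (ℕ → ℕ) → ℕ → ℤ
hstar d L m =
  sumℤ (map (λ j → sign j ℤ.* (+ (suc d C j)) ℤ.* (+ L (m ∸ j))) (upTo (suc m)))

-- The lattice points of t · P_{M_n[k,ℓ]} are the x ∈ ℤⁿ with 0 ≤ xᵢ ≤ t, Σ x = 2t,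
-- x₁ + ⋯ + x_{n-ℓ-1} ≤ t and x₁ + ⋯ + x_{n-k} ≥ t: necessity by evaluating linear
-- functionals on the vertices, sufficiency by greedily peeling off vertices e_a + e_b.
-- Inside the lattice points of t · Δ(2, n) = t · P_{U_{2,n}}, those of M_n[1,ℓ] are cut out
-- by the first prefix condition, those of M_n[1,n-k-1] (after reversing the coordinates)
-- by the second, and those of M_n[k,ℓ] by both. As n - ℓ - 1 ≤ n - k every point satisfies
-- one of the two, so inclusion–exclusion gives L_{M_n[k,ℓ]} + L_{U_{2,n}} = L_{M_n[1,ℓ]} + L_{M_n[1,n-k-1]}.
-- All four polytopes have dimension n - 1 (on the hyperplane Σ x = 2 affine and linear
-- independence agree, and n explicit vertices are independent), and at a fixed dimension
-- h* is linear in the Ehrhart function.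

module Submission where

module LatticePathBases where

  open import Defs
  open import Data.Bool using (true; false; if_then_else_; T)
  open import Data.Nat using (ℕ; suc; _+_; _≤_; _<_; _≤ᵇ_; z≤n; s≤s; _≤?_)
  open import Data.Nat.Properties
  open import Data.Product using (_×_; _,_; proj₁; proj₂; ∃₂)
  open import Data.Empty using (⊥-elim)
  open import Relation.Nullary using (yes; no)
  open import Relation.Nullary.Decidable using (T?)
  open import Relation.Binary.PropositionalEquality
  open import Data.List using (map; upTo)
  open import Data.List.Membership.Propositional using (_∈_; find; lose)
  open import Data.List.Membership.Propositional.Properties
  open import Data.List.Relation.Unary.All as All using (All)
  open import Data.List.Relation.Unary.All.Properties using (all⁺; all⁻)
  open import Data.Bool.Properties using (T-∧)
  open import Function.Bundles using (Equivalence)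
  open import Function using (_∘_)

  record IsBasis (n u v a b : ℕ) : Set where
    constructor isBasis
    field
      1≤a : 1 ≤ a
      a<b : a < b
      b≤n : b ≤ n
      u≤b : u ≤ b
      a≤v : a ≤ v

  reached : ℕ → ℕ → ℕ
  reached x t = if x ≤ᵇ t then 1 else 0

  reached-yes : ∀ {x t} → x ≤ t → reached x t ≡ 1
  reached-yes {x} {t} x≤t with x ≤ᵇ t | ≤⇒≤ᵇ x≤t
  ... | true | _ = refl

  reached-no : ∀ {x t} → t < x → reached x t ≡ 0
  reached-no {x} {t} t<x with x ≤ᵇ t in eq
  ... | false = refl
  ... | true = ⊥-elim (<⇒≱ t<x (≤ᵇ⇒≤ x t (subst T (sym eq) _)))

  reached≤1 : ∀ x t → reached x t ≤ 1
  reached≤1 x t with x ≤ᵇ t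
  ... | true = ≤-refl
  ... | false = z≤n

  reached-antitone : ∀ {x y} t → x ≤ y → reached y t ≤ reached x t
  reached-antitone {x} {y} t x≤y with y ≤? t
  ... | yes y≤t = ≤-reflexive (trans (reached-yes y≤t) (sym (reached-yes (≤-trans x≤y y≤t))))
  ... | no y≰t = subst (_≤ reached x t) (sym (reached-no (≰⇒> y≰t))) z≤n

  ∈-pairs⁺ : ∀ {n a b} → a < b → b < n → (suc a , suc b) ∈ pairs n
  ∈-pairs⁺ {n} {a} {b} a<b b<n =
    ∈-concatMap⁺ (λ b → map (λ a → (suc a , suc b)) (upTo b))
      (lose (∈-upTo⁺ b<n) (∈-map⁺ (λ a → (suc a , suc b)) (∈-upTo⁺ a<b)))

  ∈-pairs⁻ : ∀ {n B} → B ∈ pairs n → ∃₂ λ a b → a < b × b < n × B ≡ (suc a , suc b)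
  ∈-pairs⁻ {n} p
    with find (∈-concatMap⁻ (λ b → map (λ a → (suc a , suc b)) (upTo b)) {xs = upTo n} p)
  ... | b , b∈ , q with ∈-map⁻ (λ a → (suc a , suc b)) q
  ... | a , a∈ , refl = a , b , ∈-upTo⁻ a∈ , ∈-upTo⁻ b∈ , refl

  private
    between-at : ∀ {n U L B t} → T (between n U L B) → t ≤ n →
      height L t ≤ height B t × height B t ≤ height U t
    between-at {n} {U} {L} {B} h t≤n =
      let bounds = Equivalence.to T-∧ (All.lookup (all⁺ _ (upTo (suc n)) h) (∈-upTo⁺ (s≤s t≤n)))
      in ≤ᵇ⇒≤ _ _ (proj₁ bounds) , ≤ᵇ⇒≤ _ _ (proj₂ bounds)

  -- Only the heights at t = b and t = v matter: they force u ≤ b and a ≤ v.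
  between⁻ : ∀ {n u v a b} → a < b → b ≤ n → v < n →
    T (between n (1 , u) (v , n) (a , b)) → u ≤ b × a ≤ v
  between⁻ {n} {u} {v} {a} {b} a<b b≤n v<n h = u≤b , a≤v
    where
    u≤b : u ≤ b
    u≤b with u ≤? b
    ... | yes u≤b = u≤b
    ... | no u≰b = ⊥-elim (<⇒≱ (≤-refl {2}) (subst₂ _≤_ at-b-B at-b-U (proj₂ (between-at {n} {1 , u} {v , n} {a , b} h b≤n))))
      where
      at-b-B : reached a b + reached b b ≡ 2
      at-b-B = cong₂ _+_ (reached-yes (<⇒≤ a<b)) (reached-yes {b} ≤-refl)
      at-b-U : reached 1 b + reached u b ≡ 1
      at-b-U = cong₂ _+_ (reached-yes {1} (≤-trans (s≤s z≤n) a<b)) (reached-no (≰⇒> u≰b))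
    a≤v : a ≤ v
    a≤v with a ≤? v
    ... | yes a≤v = a≤v
    ... | no a≰v = ⊥-elim (<⇒≱ (≤-refl {1}) (subst₂ _≤_ at-v-L at-v-B (proj₁ (between-at {n} {1 , u} {v , n} {a , b} h (<⇒≤ v<n)))))
      where
      at-v-L : reached v v + reached n v ≡ 1
      at-v-L = cong₂ _+_ (reached-yes {v} ≤-refl) (reached-no {n} v<n)
      at-v-B : reached a v + reached b v ≡ 0
      at-v-B = cong₂ _+_ (reached-no (≰⇒> a≰v)) (reached-no (<-trans (≰⇒> a≰v) a<b))

  between⁺ : ∀ {n u v a b} → 1 ≤ a → b ≤ n → u ≤ b → a ≤ v →
    T (between n (1 , u) (v , n) (a , b))
  between⁺ {n} {u} {v} {a} {b} 1≤a b≤n u≤b a≤v = all⁻ _ {upTo (suc n)} (All.tabulate λ {t} _ →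
    Equivalence.from T-∧
      ( ≤⇒≤ᵇ (+-mono-≤ (reached-antitone t a≤v) (reached-antitone t b≤n))
      , ≤⇒≤ᵇ (+-mono-≤ (reached-antitone t 1≤a) (reached-antitone t u≤b))))

  ∈-bases⁻ : ∀ {n u v B} → v < n → B ∈ basesLPM n (1 , u) (v , n) → IsBasis n u v (proj₁ B) (proj₂ B)
  ∈-bases⁻ {n} {u} {v} v<n p with ∈-filter⁻ (T? ∘ between n (1 , u) (v , n)) {xs = pairs n} p
  ... | B∈ , h with ∈-pairs⁻ {n} B∈
  ... | a , b , a<b , b<n , refl with between⁻ (s≤s a<b) b<n v<n h
  ... | u≤b , a≤v = isBasis (s≤s z≤n) (s≤s a<b) b<n u≤b a≤v

  ∈-bases⁺ : ∀ {n u v a b} → IsBasis n u v a b → (a , b) ∈ basesLPM n (1 , u) (v , n)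
  ∈-bases⁺ {n} {u} {v} {suc a} {suc b} (isBasis _ (s≤s a<b) b≤n u≤b a≤v) =
    ∈-filter⁺ (T? ∘ between n (1 , u) (v , n)) (∈-pairs⁺ a<b b≤n) (between⁺ (s≤s z≤n) b≤n u≤b a≤v)

module IntegerEmbedding where

  open import Data.Nat as ℕ using (ℕ)
  open import Data.Integer as ℤ using (ℤ; +_)
  import Data.Integer.Properties as ℤP
  open import Data.Rational as ℚ using (ℚ; _+_; _≤_)
  open import Data.Rational.Properties
  import Data.Rational.Unnormalised as ℚᵘ
  import Data.Rational.Unnormalised.Properties as ℚᵘP
  open import Relation.Binary.PropositionalEquality

  fromℤ : ℤ → ℚ
  fromℤ z = z ℚ./ 1

  fromℕ : ℕ → ℚ
  fromℕ k = fromℤ (+ k)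

  private
    toℚᵘ-fromℤ : ∀ z → ℚ.toℚᵘ (fromℤ z) ℚᵘ.≃ ℚᵘ.mkℚᵘ z 0
    toℚᵘ-fromℤ z = toℚᵘ-fromℚᵘ (ℚᵘ.mkℚᵘ z 0)

  fromℤ-+ : ∀ a b → fromℤ (a ℤ.+ b) ≡ fromℤ a + fromℤ b
  fromℤ-+ a b = toℚᵘ-injective (ℚᵘP.≃-trans (toℚᵘ-fromℤ (a ℤ.+ b)) (ℚᵘP.≃-sym
    (ℚᵘP.≃-trans (toℚᵘ-homo-+ (fromℤ a) (fromℤ b))
      (ℚᵘP.≃-trans (ℚᵘP.+-cong (toℚᵘ-fromℤ a) (toℚᵘ-fromℤ b)) (ℚᵘ.*≡* (lemma a b))))))
    where
    open import Data.Integer.Solver using (module +-*-Solver)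
    open +-*-Solver
    lemma : ∀ a b → (a ℤ.* + 1 ℤ.+ b ℤ.* + 1) ℤ.* + 1 ≡ (a ℤ.+ b) ℤ.* (+ 1 ℤ.* + 1)
    lemma = solve 2 (λ a b → (a :* con (+ 1) :+ b :* con (+ 1)) :* con (+ 1)
                             := (a :+ b) :* (con (+ 1) :* con (+ 1))) refl

  fromℕ-+ : ∀ a b → fromℕ (a ℕ.+ b) ≡ fromℕ a + fromℕ b
  fromℕ-+ a b = fromℤ-+ (+ a) (+ b)

  fromℤ-cancel-≤ : ∀ {a b} → fromℤ a ≤ fromℤ b → a ℤ.≤ b
  fromℤ-cancel-≤ {a} {b} p = subst₂ ℤ._≤_ (ℤP.*-identityʳ a) (ℤP.*-identityʳ b)
    (ℚᵘP.drop-*≤* (ℚᵘP.≤-respˡ-≃ (toℚᵘ-fromℤ a) (ℚᵘP.≤-respʳ-≃ (toℚᵘ-fromℤ b) (toℚᵘ-mono-≤ p))))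

  fromℤ-mono-≤ : ∀ {a b} → a ℤ.≤ b → fromℤ a ≤ fromℤ b
  fromℤ-mono-≤ {a} {b} p = toℚᵘ-cancel-≤
    (ℚᵘP.≤-respˡ-≃ (ℚᵘP.≃-sym (toℚᵘ-fromℤ a)) (ℚᵘP.≤-respʳ-≃ (ℚᵘP.≃-sym (toℚᵘ-fromℤ b))
      (ℚᵘ.*≤* (subst₂ ℤ._≤_ (sym (ℤP.*-identityʳ a)) (sym (ℤP.*-identityʳ b)) p))))

  fromℕ-mono-≤ : ∀ {a b} → a ℕ.≤ b → fromℕ a ≤ fromℕ b
  fromℕ-mono-≤ a≤b = fromℤ-mono-≤ (ℤ.+≤+ a≤b)

  fromℤ-injective : ∀ {a b} → fromℤ a ≡ fromℤ b → a ≡ b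
  fromℤ-injective e = ℤP.≤-antisym (fromℤ-cancel-≤ (≤-reflexive e)) (fromℤ-cancel-≤ (≤-reflexive (sym e)))

module LinearCombinations where

  open import Defs
  open import Data.Nat using (ℕ; zero; suc)
  import Data.Nat.Properties as ℕP
  open import Data.Rational as ℚ using (ℚ; 0ℚ; _+_; _*_; _≤_)
  open import Data.Rational.Properties
  open import Data.Rational.Solver
  open import Data.Fin using (Fin)
  open import Data.Vec as V using (Vec; []; _∷_; lookup; zipWith; replicate)
  open import Data.Vec.Properties using (lookup-zipWith; lookup-map; lookup-replicate)
  open import Data.Vec.Relation.Binary.Pointwise.Extensional using (ext; Pointwise-≡⇒≡)
  open import Data.List as L using (List; []; _∷_; length)
  open import Data.List.Relation.Unary.All using (All; []; _∷_)
  open import Relation.Binary.PropositionalEquality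
  open +-*-Solver

  lookup-ext : ∀ {A : Set} {n} {u w : Vec A n} → (∀ i → lookup u i ≡ lookup w i) → u ≡ w
  lookup-ext h = Pointwise-≡⇒≡ (ext h)

  weightedSum : List ℚ → List ℚ → ℚ
  weightedSum (c ∷ cs) (y ∷ ys) = c * y + weightedSum cs ys
  weightedSum _ _ = 0ℚ

  module _ {n : ℕ} (F : Vec ℚ n → ℚ)
    (F-+ : ∀ u w → F (zipWith _+_ u w) ≡ F u + F w)
    (F-* : ∀ c v → F (V.map (c *_) v) ≡ c * F v)
    (F-0 : F (replicate n 0ℚ) ≡ 0ℚ) where

    linear-lincomb : ∀ c vs → F (lincomb c vs) ≡ weightedSum c (L.map F vs)
    linear-lincomb [] vs = F-0
    linear-lincomb (c ∷ cs) [] = F-0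
    linear-lincomb (c ∷ cs) (v ∷ vs) = trans (F-+ _ _) (cong₂ _+_ (F-* c v) (linear-lincomb cs vs))

  lookup-lincomb : ∀ {n} (i : Fin n) c vs →
    lookup (lincomb c vs) i ≡ weightedSum c (L.map (λ v → lookup v i) vs)
  lookup-lincomb i = linear-lincomb (λ v → lookup v i)
    (lookup-zipWith _+_ i) (λ c v → lookup-map i (c *_) v) (lookup-replicate i 0ℚ)

  lincomb≡0 : ∀ {n} c (ps : List (Vec ℚ n)) →
    (∀ i → weightedSum c (L.map (λ v → lookup v i) ps) ≡ 0ℚ) → lincomb c ps ≡ replicate n 0ℚ
  lincomb≡0 c ps h = lookup-ext λ i → trans (lookup-lincomb i c ps) (trans (h i) (sym (lookup-replicate i 0ℚ)))

  lincomb≡0⁻ : ∀ {n} c (ps : List (Vec ℚ n)) → lincomb c ps ≡ replicate n 0ℚ →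
    ∀ i → weightedSum c (L.map (λ v → lookup v i) ps) ≡ 0ℚ
  lincomb≡0⁻ c ps e i = trans (sym (lookup-lincomb i c ps)) (trans (cong (λ v → lookup v i) e) (lookup-replicate i 0ℚ))

  prefixSumℚ : ∀ {n} → ℕ → Vec ℚ n → ℚ
  prefixSumℚ zero v = 0ℚ
  prefixSumℚ (suc m) [] = 0ℚ
  prefixSumℚ (suc m) (x ∷ xs) = x + prefixSumℚ m xs

  prefixSumℚ-+ : ∀ {n} m (u w : Vec ℚ n) →
    prefixSumℚ m (zipWith _+_ u w) ≡ prefixSumℚ m u + prefixSumℚ m w
  prefixSumℚ-+ zero u w = refl
  prefixSumℚ-+ (suc m) [] [] = refl
  prefixSumℚ-+ (suc m) (x ∷ u) (y ∷ w) rewrite prefixSumℚ-+ m u w =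
    solve 4 (λ x y a b → (x :+ y) :+ (a :+ b) := (x :+ a) :+ (y :+ b)) refl x y (prefixSumℚ m u) (prefixSumℚ m w)

  prefixSumℚ-* : ∀ {n} m c (v : Vec ℚ n) → prefixSumℚ m (V.map (c *_) v) ≡ c * prefixSumℚ m v
  prefixSumℚ-* zero c v = sym (*-zeroʳ c)
  prefixSumℚ-* (suc m) c [] = sym (*-zeroʳ c)
  prefixSumℚ-* (suc m) c (x ∷ v) rewrite prefixSumℚ-* m c v = sym (*-distribˡ-+ c x (prefixSumℚ m v))

  prefixSumℚ-0 : ∀ {n} m → prefixSumℚ m (replicate n 0ℚ) ≡ 0ℚ
  prefixSumℚ-0 zero = refl
  prefixSumℚ-0 {zero} (suc m) = refl
  prefixSumℚ-0 {suc n} (suc m) rewrite prefixSumℚ-0 {n} m = refl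

  prefixSumℚ-lincomb : ∀ {n} m c (vs : List (Vec ℚ n)) →
    prefixSumℚ m (lincomb c vs) ≡ weightedSum c (L.map (prefixSumℚ m) vs)
  prefixSumℚ-lincomb m = linear-lincomb (prefixSumℚ m) (prefixSumℚ-+ m) (prefixSumℚ-* m) (prefixSumℚ-0 m)

  weightedSum-≥ : ∀ lo c ys → length c ≡ length ys → All (0ℚ ≤_) c → All (lo ≤_) ys →
    lo * sumℚ c ≤ weightedSum c ys
  weightedSum-≥ lo [] [] _ _ _ = ≤-reflexive (*-zeroʳ lo)
  weightedSum-≥ lo (c ∷ cs) (y ∷ ys) e (0≤c ∷ 0≤cs) (lo≤y ∷ lo≤ys) =
    ≤-trans (≤-reflexive (trans (*-distribˡ-+ lo c (sumℚ cs)) (cong (_+ (lo * sumℚ cs)) (*-comm lo c))))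
      (+-mono-≤ (*-monoˡ-≤-nonNeg c {{ℚ.nonNegative 0≤c}} lo≤y) (weightedSum-≥ lo cs ys (ℕP.suc-injective e) 0≤cs lo≤ys))

  weightedSum-≤ : ∀ hi c ys → length c ≡ length ys → All (0ℚ ≤_) c → All (_≤ hi) ys →
    weightedSum c ys ≤ hi * sumℚ c
  weightedSum-≤ hi [] [] _ _ _ = ≤-reflexive (sym (*-zeroʳ hi))
  weightedSum-≤ hi (c ∷ cs) (y ∷ ys) e (0≤c ∷ 0≤cs) (y≤hi ∷ ys≤hi) =
    ≤-trans (+-mono-≤ (*-monoˡ-≤-nonNeg c {{ℚ.nonNegative 0≤c}} y≤hi) (weightedSum-≤ hi cs ys (ℕP.suc-injective e) 0≤cs ys≤hi))
      (≤-reflexive (sym (trans (*-distribˡ-+ hi c (sumℚ cs)) (cong (_+ (hi * sumℚ cs)) (*-comm hi c)))))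

  weightedSum-const : ∀ y c ys → length c ≡ length ys → All (_≡ y) ys → weightedSum c ys ≡ y * sumℚ c
  weightedSum-const y [] [] _ _ = sym (*-zeroʳ y)
  weightedSum-const y (c ∷ cs) (.y ∷ ys) e (refl ∷ ys≡y) rewrite weightedSum-const y cs ys (ℕP.suc-injective e) ys≡y =
    solve 3 (λ y c s → c :* y :+ y :* s := y :* (c :+ s)) refl y c (sumℚ cs)

module PrefixSums where

  open import Data.Nat using (ℕ; zero; suc; _+_; _≤_; _<_; z≤n; _≤?_)
  open import Data.Nat.Properties
  open import Relation.Nullary using (yes; no)
  open import Relation.Binary.PropositionalEquality
  open import Function using (_∘_)

  prefixSum : (ℕ → ℕ) → ℕ → ℕ
  prefixSum f zero = 0
  prefixSum f (suc m) = prefixSum f m + f m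

  prefixSum-suc : ∀ f m → prefixSum f (suc m) ≡ f 0 + prefixSum (f ∘ suc) m
  prefixSum-suc f zero = +-comm 0 (f 0)
  prefixSum-suc f (suc m) rewrite prefixSum-suc f m = +-assoc (f 0) (prefixSum (f ∘ suc) m) (f (suc m))

  prefixSum-0 : ∀ m → prefixSum (λ _ → 0) m ≡ 0
  prefixSum-0 zero = refl
  prefixSum-0 (suc m) rewrite prefixSum-0 m = refl

  prefixSum-mono : ∀ f {m m'} → m ≤ m' → prefixSum f m ≤ prefixSum f m'
  prefixSum-mono f {m} {zero} z≤n = ≤-refl
  prefixSum-mono f {m} {suc m'} m≤1+m' with m ≤? m'
  ... | yes m≤m' = ≤-trans (prefixSum-mono f m≤m') (m≤m+n (prefixSum f m') (f m'))
  ... | no m≰m' rewrite ≤-antisym m≤1+m' (≰⇒> m≰m') = ≤-refl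

  ≤-prefixSum : ∀ f {j m} → j < m → f j ≤ prefixSum f m
  ≤-prefixSum f {j} j<m = ≤-trans (m≤n+m (f j) (prefixSum f j)) (prefixSum-mono f j<m)

module IndicatorVectors where

  open import Defs
  open IntegerEmbedding
  open LinearCombinations
  open PrefixSums
  open LatticePathBases using (reached; reached-yes; reached-no)
  open import Data.Bool using (Bool; true; false; if_then_else_; _∨_; T)
  open import Data.Nat as ℕ using (ℕ; zero; suc; _≡ᵇ_; s≤s)
  import Data.Nat.Properties as ℕP
  open import Data.Rational using (0ℚ; 1ℚ; _+_)
  open import Data.Fin using (Fin; toℕ)
  open import Data.Vec using (lookup; tabulate)
  open import Data.Product using (_,_)
  open import Data.Vec.Properties using (lookup∘tabulate; tabulate-cong)
  open import Data.Empty using (⊥-elim)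
  open import Relation.Binary.Definitions using (tri<; tri≈; tri>)
  open import Relation.Binary.PropositionalEquality
  open import Function using (_∘_)
  open import Algebra.Properties.CommutativeSemigroup ℕP.+-commutativeSemigroup
    using () renaming (interchange to +-interchange)

  bit : Bool → ℕ
  bit c = if c then 1 else 0

  bit≤1 : ∀ c → bit c ℕ.≤ 1
  bit≤1 true = ℕP.≤-refl
  bit≤1 false = ℕ.z≤n

  ≡ᵇ-refl : ∀ m → (m ≡ᵇ m) ≡ true
  ≡ᵇ-refl zero = refl
  ≡ᵇ-refl (suc m) = ≡ᵇ-refl m

  ≢⇒≡ᵇ-false : ∀ {m n} → m ≢ n → (m ≡ᵇ n) ≡ false
  ≢⇒≡ᵇ-false {m} {n} m≢n with m ≡ᵇ n in eq
  ... | false = refl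
  ... | true = ⊥-elim (m≢n (ℕP.≡ᵇ⇒≡ m n (subst T (sym eq) _)))

  -- coordinate j of e_{a,b}, with coordinates numbered from 1 as in Defs
  oneOf : ℕ → ℕ → ℕ → ℕ
  oneOf a b j = bit ((j ≡ᵇ a) ∨ (j ≡ᵇ b))

  oneOf-split : ∀ j {a b} → a ≢ b → oneOf a b j ≡ bit (j ≡ᵇ a) ℕ.+ bit (j ≡ᵇ b)
  oneOf-split j {a} {b} a≢b with j ≡ᵇ a in j≡a | j ≡ᵇ b in j≡b
  ... | false | false = refl
  ... | false | true = refl
  ... | true | false = refl
  ... | true | true = ⊥-elim (a≢b (trans (sym (ℕP.≡ᵇ⇒≡ j a (subst T (sym j≡a) _))) (ℕP.≡ᵇ⇒≡ j b (subst T (sym j≡b) _))))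

  reached-suc : ∀ x m → 1 ℕ.≤ x → reached x (suc m) ≡ reached x m ℕ.+ bit (suc m ≡ᵇ x)
  reached-suc x m 1≤x with ℕP.<-cmp x (suc m)
  ... | tri< x<1+m _ _
    rewrite reached-yes {x} {suc m} (ℕP.<⇒≤ x<1+m) | reached-yes {x} {m} (ℕP.≤-pred x<1+m)
          | ≢⇒≡ᵇ-false {suc m} {x} (λ e → ℕP.<-irrefl (sym e) x<1+m) = refl
  ... | tri≈ _ refl _
    rewrite reached-yes {suc m} {suc m} ℕP.≤-refl | reached-no {suc m} {m} ℕP.≤-refl | ≡ᵇ-refl m = refl
  ... | tri> _ _ 1+m<x
    rewrite reached-no {x} {suc m} 1+m<x | reached-no {x} {m} (ℕP.<-trans ℕP.≤-refl 1+m<x)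
          | ≢⇒≡ᵇ-false {suc m} {x} (λ e → ℕP.<-irrefl e 1+m<x) = refl

  prefixSum-oneOf : ∀ {a b} m → 1 ℕ.≤ a → 1 ℕ.≤ b → a ≢ b →
    prefixSum (oneOf a b ∘ suc) m ≡ reached a m ℕ.+ reached b m
  prefixSum-oneOf {a} {b} zero 1≤a 1≤b _ = sym (cong₂ ℕ._+_ (reached-no {a} {0} 1≤a) (reached-no {b} {0} 1≤b))
  prefixSum-oneOf {a} {b} (suc m) 1≤a 1≤b a≢b = begin
    prefixSum (oneOf a b ∘ suc) m ℕ.+ oneOf a b (suc m)
      ≡⟨ cong₂ ℕ._+_ (prefixSum-oneOf m 1≤a 1≤b a≢b) (oneOf-split (suc m) a≢b) ⟩
    (reached a m ℕ.+ reached b m) ℕ.+ (bit (suc m ≡ᵇ a) ℕ.+ bit (suc m ≡ᵇ b))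
      ≡⟨ +-interchange (reached a m) (reached b m) (bit (suc m ≡ᵇ a)) (bit (suc m ≡ᵇ b)) ⟩
    (reached a m ℕ.+ bit (suc m ≡ᵇ a)) ℕ.+ (reached b m ℕ.+ bit (suc m ≡ᵇ b))
      ≡⟨ sym (cong₂ ℕ._+_ (reached-suc a m 1≤a) (reached-suc b m 1≤b)) ⟩
    reached a (suc m) ℕ.+ reached b (suc m) ∎
    where open ≡-Reasoning

  prefixSumℚ-tabulate : ∀ f m n → m ℕ.≤ n →
    prefixSumℚ m (tabulate {n = n} (λ i → fromℕ (f (toℕ i)))) ≡ fromℕ (prefixSum f m)
  prefixSumℚ-tabulate f zero n _ = refl
  prefixSumℚ-tabulate f (suc m) (suc n) (s≤s m≤n) = begin
    fromℕ (f 0) + prefixSumℚ m (tabulate (λ i → fromℕ (f (suc (toℕ i)))))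
      ≡⟨ cong (fromℕ (f 0) +_) (prefixSumℚ-tabulate (f ∘ suc) m n m≤n) ⟩
    fromℕ (f 0) + fromℕ (prefixSum (f ∘ suc) m)
      ≡⟨ sym (fromℕ-+ (f 0) _) ⟩
    fromℕ (f 0 ℕ.+ prefixSum (f ∘ suc) m)
      ≡⟨ cong fromℕ (sym (prefixSum-suc f m)) ⟩
    fromℕ (prefixSum f (suc m)) ∎
    where open ≡-Reasoning

  indicator≡tabulate : ∀ n a b → indicator n (a , b) ≡ tabulate (λ i → fromℕ (oneOf a b (suc (toℕ i))))
  indicator≡tabulate n a b = tabulate-cong λ i → bitℚ ((suc (toℕ i) ≡ᵇ a) ∨ (suc (toℕ i) ≡ᵇ b))
    where
    bitℚ : ∀ c → (if c then 1ℚ else 0ℚ) ≡ fromℕ (bit c)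
    bitℚ true = refl
    bitℚ false = refl

  lookup-indicator : ∀ n a b (i : Fin n) → lookup (indicator n (a , b)) i ≡ fromℕ (oneOf a b (suc (toℕ i)))
  lookup-indicator n a b i = trans (cong (λ v → lookup v i) (indicator≡tabulate n a b)) (lookup∘tabulate _ i)

  prefixSumℚ-indicator : ∀ n {a b} m → 1 ℕ.≤ a → a ℕ.< b → m ℕ.≤ n →
    prefixSumℚ m (indicator n (a , b)) ≡ fromℕ (reached a m ℕ.+ reached b m)
  prefixSumℚ-indicator n {a} {b} m 1≤a a<b m≤n = begin
    prefixSumℚ m (indicator n (a , b))
      ≡⟨ cong (prefixSumℚ m) (indicator≡tabulate n a b) ⟩
    prefixSumℚ m (tabulate {n = n} (λ i → fromℕ (oneOf a b (suc (toℕ i)))))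
      ≡⟨ prefixSumℚ-tabulate (oneOf a b ∘ suc) m n m≤n ⟩
    fromℕ (prefixSum (oneOf a b ∘ suc) m)
      ≡⟨ cong fromℕ (prefixSum-oneOf m 1≤a (ℕP.≤-trans 1≤a (ℕP.<⇒≤ a<b)) (ℕP.<⇒≢ a<b)) ⟩
    fromℕ (reached a m ℕ.+ reached b m) ∎
    where open ≡-Reasoning

module LatticePointInequalities where

  open import Data.Nat as ℕ using (ℕ; zero; suc)
  open import Data.Integer as ℤ using (ℤ; +_)
  open import Data.Vec using (Vec; []; _∷_; lookup)
  open import Relation.Binary.PropositionalEquality using (_≡_)

  prefixSumℤ : ∀ {n} → ℕ → Vec ℤ n → ℤ
  prefixSumℤ zero v = + 0
  prefixSumℤ (suc m) [] = + 0
  prefixSumℤ (suc m) (x ∷ xs) = x ℤ.+ prefixSumℤ m xs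

  -- For p = n - ℓ - 1 and q = n - k these describe the lattice points of t · P_{M_n[k,ℓ]}.
  record Ineqs (n p q t : ℕ) (x : Vec ℤ n) : Set where
    constructor ineqs
    field
      0≤x : ∀ i → + 0 ℤ.≤ lookup x i
      x≤t : ∀ i → lookup x i ℤ.≤ + t
      total : prefixSumℤ n x ≡ + (t ℕ.+ t)
      prefix≤ : prefixSumℤ p x ℤ.≤ + t
      prefix≥ : + t ℤ.≤ prefixSumℤ q x

module Necessity where

  open import Defs
  open IntegerEmbedding
  open LinearCombinations
  open IndicatorVectors
  open LatticePointInequalities
  open LatticePathBases using (IsBasis; isBasis; ∈-bases⁻; reached; reached-yes; reached-no; reached≤1)
  open import Data.Nat as ℕ using (ℕ; zero; suc; z≤n)
  import Data.Nat.Properties as ℕP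
  open import Data.Integer as ℤ using (ℤ; +_)
  open import Data.Rational as ℚ using (ℚ; 0ℚ; 1ℚ; _+_; _*_; _≤_)
  open import Data.Rational.Properties
  open import Data.Rational.Solver
  open import Data.Fin using (toℕ)
  open import Data.Vec using (Vec; []; _∷_; lookup)
  open import Data.Vec.Properties using (lookup-map)
  open import Data.List using (List; length; map)
  open import Data.List.Properties using (length-map)
  open import Data.List.Relation.Unary.All as All using (All)
  open import Data.List.Relation.Unary.All.Properties as AllP using ()
  open import Data.Product using (_,_)
  open import Relation.Binary.PropositionalEquality
  open import Function using (_∘_)

  prefixSumℚ-toℚvec : ∀ {n} m (x : Vec ℤ n) → prefixSumℚ m (toℚvec x) ≡ fromℤ (prefixSumℤ m x)
  prefixSumℚ-toℚvec zero x = refl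
  prefixSumℚ-toℚvec (suc m) [] = refl
  prefixSumℚ-toℚvec (suc m) (y ∷ x) =
    trans (cong (λ s → fromℤ y + s) (prefixSumℚ-toℚvec m x)) (sym (fromℤ-+ y (prefixSumℤ m x)))

  module _ (n u v t : ℕ) (x : Vec ℤ n) (v<n : v ℕ.< n) where

    private
      vs = polytopeLPM n (1 , u) (v , n)

      all-vertices : ∀ {P : Vec ℚ n → Set} → (∀ {a b} → IsBasis n u v a b → P (indicator n (a , b))) → All P vs
      all-vertices f = AllP.map⁺ (All.tabulate λ {B} B∈ → f (∈-bases⁻ {n} {u} {v} {B} v<n B∈))

    module Functionals (c : List ℚ) (|c| : length c ≡ length vs) (0≤c : All (0ℚ ℚ.≤_) c)
             (Σc : sumℚ c ≡ fromℕ t) (x≡ : lincomb c vs ≡ toℚvec x)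
             (F : Vec ℚ n → ℚ) (F-lincomb : F (lincomb c vs) ≡ weightedSum c (map F vs)) where

      private
        F[x] : F (toℚvec x) ≡ weightedSum c (map F vs)
        F[x] = trans (cong F (sym x≡)) F-lincomb

        |c|′ : length c ≡ length (map F vs)
        |c|′ = trans |c| (sym (length-map F vs))

      functional-≤ : ∀ hi → All ((_≤ hi) ∘ F) vs → F (toℚvec x) ≤ hi * fromℕ t
      functional-≤ hi F≤hi = ≤-trans (≤-reflexive F[x])
        (≤-trans (weightedSum-≤ hi c (map F vs) |c|′ 0≤c (AllP.map⁺ F≤hi)) (≤-reflexive (cong (hi *_) Σc)))

      functional-≡ : ∀ y → All ((_≡ y) ∘ F) vs → F (toℚvec x) ≡ y * fromℕ t
      functional-≡ y F≡y = trans F[x]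
        (trans (weightedSum-const y c (map F vs) |c|′ (AllP.map⁺ F≡y)) (cong (y *_) Σc))

      functional-≥ : ∀ lo → All ((lo ≤_) ∘ F) vs → lo * fromℕ t ≤ F (toℚvec x)
      functional-≥ lo lo≤F = ≤-trans (≤-reflexive (cong (lo *_) (sym Σc)))
        (≤-trans (weightedSum-≥ lo c (map F vs) |c|′ 0≤c (AllP.map⁺ lo≤F)) (≤-reflexive (sym F[x])))

    inDilate⇒ineqs : ∀ p q → p ℕ.< u → p ℕ.≤ n → v ℕ.≤ q → q ℕ.≤ n → InDilate vs t x → Ineqs n p q t x
    inDilate⇒ineqs p q p<u p≤n v≤q q≤n (c , |c| , 0≤c , Σc , x≡) = ineqs 0≤x x≤t total prefix≤ prefix≥
      where
      open Functionals c |c| 0≤c Σc x≡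

      coord : ∀ i → lookup (toℚvec x) i ≡ fromℤ (lookup x i)
      coord i = lookup-map i fromℤ x

      prefix : ∀ m → prefixSumℚ m (toℚvec x) ≡ fromℤ (prefixSumℤ m x)
      prefix m = prefixSumℚ-toℚvec m x

      0≤x : ∀ i → + 0 ℤ.≤ lookup x i
      0≤x i = fromℤ-cancel-≤ (≤-trans (≤-reflexive (sym (*-zeroˡ (fromℕ t))))
        (≤-trans (functional-≥ (λ w → lookup w i) (lookup-lincomb i c vs) 0ℚ
          (all-vertices λ {a} {b} _ → ≤-trans (fromℕ-mono-≤ {0} {oneOf a b (suc (toℕ i))} z≤n) (≤-reflexive (sym (lookup-indicator n a b i)))))
          (≤-reflexive (coord i))))

      x≤t : ∀ i → lookup x i ℤ.≤ + t
      x≤t i = fromℤ-cancel-≤ (≤-trans (≤-reflexive (sym (coord i)))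
        (≤-trans (functional-≤ (λ w → lookup w i) (lookup-lincomb i c vs) 1ℚ
          (all-vertices λ {a} {b} _ → ≤-trans (≤-reflexive (lookup-indicator n a b i)) (fromℕ-mono-≤ {oneOf a b (suc (toℕ i))} (bit≤1 _))))
          (≤-reflexive (*-identityˡ (fromℕ t)))))

      total = fromℤ-injective (begin
        fromℤ (prefixSumℤ n x)    ≡⟨ sym (prefix n) ⟩
        prefixSumℚ n (toℚvec x)   ≡⟨ functional-≡ (prefixSumℚ n) (prefixSumℚ-lincomb n c vs) 2ℚ (all-vertices two) ⟩
        2ℚ * fromℕ t              ≡⟨ solve 1 (λ y → (con 1ℚ :+ con 1ℚ) :* y := y :+ y) refl (fromℕ t) ⟩
        fromℕ t + fromℕ t         ≡⟨ sym (fromℕ-+ t t) ⟩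
        fromℕ (t ℕ.+ t)           ∎)
        where
        open ≡-Reasoning
        open +-*-Solver
        2ℚ = 1ℚ + 1ℚ
        two : ∀ {a b} → IsBasis n u v a b → prefixSumℚ n (indicator n (a , b)) ≡ 2ℚ
        two (isBasis 1≤a a<b b≤n _ _) = trans (prefixSumℚ-indicator n n 1≤a a<b ℕP.≤-refl)
          (cong fromℕ (cong₂ ℕ._+_ (reached-yes (ℕP.≤-trans (ℕP.<⇒≤ a<b) b≤n)) (reached-yes b≤n)))

      prefix≤ : prefixSumℤ p x ℤ.≤ + t
      prefix≤ = fromℤ-cancel-≤ (≤-trans (≤-reflexive (sym (prefix p)))
        (≤-trans (functional-≤ (prefixSumℚ p) (prefixSumℚ-lincomb p c vs) 1ℚ (all-vertices ≤1))
          (≤-reflexive (*-identityˡ (fromℕ t)))))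
        where
        -- b > p, so only a can lie in the first p coordinates
        ≤1 : ∀ {a b} → IsBasis n u v a b → prefixSumℚ p (indicator n (a , b)) ≤ 1ℚ
        ≤1 {a} {b} (isBasis 1≤a a<b _ u≤b _) = ≤-trans (≤-reflexive (prefixSumℚ-indicator n p 1≤a a<b p≤n))
          (fromℕ-mono-≤ {_} {1} (ℕP.+-mono-≤ (reached≤1 a p) (ℕP.≤-reflexive (reached-no {b} (ℕP.<-≤-trans p<u u≤b)))))

      prefix≥ : + t ℤ.≤ prefixSumℤ q x
      prefix≥ = fromℤ-cancel-≤ (≤-trans (≤-reflexive (sym (*-identityˡ (fromℕ t))))
        (≤-trans (functional-≥ (prefixSumℚ q) (prefixSumℚ-lincomb q c vs) 1ℚ (all-vertices 1≤))
          (≤-reflexive (prefix q))))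
        where
        -- a ≤ q, so a lies in the first q coordinates
        1≤ : ∀ {a b} → IsBasis n u v a b → 1ℚ ≤ prefixSumℚ q (indicator n (a , b))
        1≤ {a} {b} (isBasis 1≤a a<b _ _ a≤v) = ≤-trans
          (fromℕ-mono-≤ {1} (ℕP.≤-trans (ℕP.≤-reflexive (sym (reached-yes (ℕP.≤-trans a≤v v≤q)))) (ℕP.m≤m+n (reached a q) (reached b q))))
          (≤-reflexive (sym (prefixSumℚ-indicator n q 1≤a a<b q≤n)))

module GreedyDecomposition where

  open PrefixSums
  open IndicatorVectors using (bit; ≡ᵇ-refl; ≢⇒≡ᵇ-false; reached-suc)
  open LatticePathBases using (reached; reached-yes; reached-no; reached≤1)
  open import Data.Nat
  open import Data.Nat.Properties
  open import Data.Empty using (⊥-elim)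
  open import Relation.Nullary using (yes; no)
  open import Relation.Binary.PropositionalEquality
  open import Algebra.Properties.CommutativeSemigroup +-commutativeSemigroup
    using () renaming (interchange to +-interchange)

  -- Ineqs for a weight sequence, with positions counted from 0
  record Ineqsℕ (n p q T : ℕ) (f : ℕ → ℕ) : Set where
    constructor ineqsℕ
    field
      f≤T : ∀ j → j < n → f j ≤ T
      total : prefixSum f n ≡ T + T
      prefix≤ : prefixSum f p ≤ T
      prefix≥ : T ≤ prefixSum f q

  record Crossing (f : ℕ → ℕ) (thr m : ℕ) : Set where
    constructor crossingAt
    field
      pos : ℕ
      pos<m : pos < m
      below : prefixSum f pos < thr
      above : thr ≤ prefixSum f (suc pos)

  crossing : ∀ f thr m → 1 ≤ thr → thr ≤ prefixSum f m → Crossing f thr m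
  crossing f thr zero 1≤thr thr≤0 = ⊥-elim (<⇒≱ 1≤thr thr≤0)
  crossing f thr (suc m) 1≤thr thr≤ with thr ≤? prefixSum f m
  ... | no thr≰ = crossingAt m ≤-refl (≰⇒> thr≰) thr≤
  ... | yes thr≤′ with crossing f thr m 1≤thr thr≤′
  ...   | crossingAt j j<m below above = crossingAt j (m<n⇒m<1+n j<m) below above

  crossing-≤ : ∀ f {thr j i} → prefixSum f j < thr → thr ≤ prefixSum f (suc i) → j ≤ i
  crossing-≤ f {thr} {j} {i} below above with j ≤? i
  ... | yes j≤i = j≤i
  ... | no j≰i = ⊥-elim (<⇒≱ below (≤-trans above (prefixSum-mono f (≰⇒> j≰i))))

  pairCount : ℕ → ℕ → ℕ → ℕ
  pairCount a b j = bit (j ≡ᵇ a) + bit (j ≡ᵇ b)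

  pairCount-a : ∀ {a b} → a ≢ b → pairCount a b a ≡ 1
  pairCount-a {a} {b} a≢b rewrite ≡ᵇ-refl a | ≢⇒≡ᵇ-false a≢b = refl

  pairCount-b : ∀ {a b} → a ≢ b → pairCount a b b ≡ 1
  pairCount-b {a} {b} a≢b rewrite ≡ᵇ-refl b | ≢⇒≡ᵇ-false (≢-sym a≢b) = refl

  pairCount-other : ∀ {a b j} → j ≢ a → j ≢ b → pairCount a b j ≡ 0
  pairCount-other j≢a j≢b rewrite ≢⇒≡ᵇ-false j≢a | ≢⇒≡ᵇ-false j≢b = refl

  prefixSum-+pairCount : ∀ f g a b → (∀ j → f j ≡ g j + pairCount a b j) →
    ∀ m → prefixSum f m ≡ prefixSum g m + (reached (suc a) m + reached (suc b) m)
  prefixSum-+pairCount f g a b f≡ zero =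
    sym (cong (prefixSum g zero +_) (cong₂ _+_ (reached-no {suc a} z<s) (reached-no {suc b} z<s)))
  prefixSum-+pairCount f g a b f≡ (suc m) = begin
    prefixSum f m + f m
      ≡⟨ cong₂ _+_ (prefixSum-+pairCount f g a b f≡ m) (f≡ m) ⟩
    (prefixSum g m + (ra m + rb m)) + (g m + (bit (m ≡ᵇ a) + bit (m ≡ᵇ b)))
      ≡⟨ +-interchange (prefixSum g m) (ra m + rb m) (g m) _ ⟩
    (prefixSum g m + g m) + ((ra m + rb m) + (bit (m ≡ᵇ a) + bit (m ≡ᵇ b)))
      ≡⟨ cong (prefixSum g (suc m) +_) (+-interchange (ra m) (rb m) (bit (m ≡ᵇ a)) (bit (m ≡ᵇ b))) ⟩
    prefixSum g (suc m) + ((ra m + bit (m ≡ᵇ a)) + (rb m + bit (m ≡ᵇ b)))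
      ≡⟨ cong (prefixSum g (suc m) +_) (sym (cong₂ _+_ (reached-suc (suc a) m (s≤s z≤n)) (reached-suc (suc b) m (s≤s z≤n)))) ⟩
    prefixSum g (suc m) + (ra (suc m) + rb (suc m)) ∎
    where
    open ≡-Reasoning
    ra = reached (suc a)
    rb = reached (suc b)

  record Decomposition (n p q T : ℕ) (f : ℕ → ℕ) : Set where
    constructor decomposition
    field
      a b : ℕ
      a<b : a < b
      b<n : b < n
      p≤b : p ≤ b
      a<q : a < q
      rest : ℕ → ℕ
      rest-ineqs : Ineqsℕ n p q T rest
      f≡rest+pair : ∀ j → f j ≡ rest j + pairCount a b j

  -- Peel e_a + e_b off f, where a is the first position of positive weight and b is
  -- the position at which the prefix sums reach T + 2.
  module Peel {n p q T f} (h : Ineqsℕ n p q (suc T) f) where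

    open Ineqsℕ h

    private
      1≤Σf : 1 ≤ prefixSum f n
      1≤Σf = subst (1 ≤_) (sym total) (s≤s z≤n)

      2+T≤Σf : 2 + T ≤ prefixSum f n
      2+T≤Σf = subst (2 + T ≤_) (sym total) (s≤s (subst (suc T ≤_) (sym (+-suc T T)) (s≤s (m≤m+n T T))))

    open Crossing (crossing f 1 n (s≤s z≤n) 1≤Σf) public
      renaming (pos to a; pos<m to a<n; below to Σ<a<1; above to 1≤Σ≤a)
    open Crossing (crossing f (2 + T) n (s≤s z≤n) 2+T≤Σf) public
      renaming (pos to b; pos<m to b<n; below to Σ<b<2+T; above to 2+T≤Σ≤b)

    Σ<a≡0 : prefixSum f a ≡ 0
    Σ<a≡0 = n<1⇒n≡0 Σ<a<1

    Σ≤a≡f[a] : prefixSum f (suc a) ≡ f a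
    Σ≤a≡f[a] = cong (_+ f a) Σ<a≡0

    1≤f[a] : 1 ≤ f a
    1≤f[a] = subst (1 ≤_) Σ≤a≡f[a] 1≤Σ≤a

    1≤f[b] : 1 ≤ f b
    1≤f[b] with f b ≟ 0
    ... | no f[b]≢0 = n≢0⇒n>0 f[b]≢0
    ... | yes f[b]≡0 = ⊥-elim (<⇒≱ Σ<b<2+T (subst (2 + T ≤_) (trans (cong (prefixSum f b +_) f[b]≡0) (+-identityʳ _)) 2+T≤Σ≤b))

    a<b : a < b
    a<b with b ≤? a
    ... | no b≰a = ≰⇒> b≰a
    ... | yes b≤a = ⊥-elim (<⇒≱ (s≤s (f≤T a a<n))
            (≤-trans 2+T≤Σ≤b (subst (prefixSum f (suc b) ≤_) Σ≤a≡f[a] (prefixSum-mono f (s≤s b≤a)))))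

    a≢b : a ≢ b
    a≢b = <⇒≢ a<b

    p≤b : p ≤ b
    p≤b with p ≤? b
    ... | yes p≤b = p≤b
    ... | no p≰b = ⊥-elim (<⇒≱ (s≤s prefix≤) (≤-trans 2+T≤Σ≤b (prefixSum-mono f (≰⇒> p≰b))))

    a<q : a < q
    a<q with q ≤? a
    ... | no q≰a = ≰⇒> q≰a
    ... | yes q≤a = ⊥-elim (<⇒≱ (s≤s z≤n) (≤-trans prefix≥ (subst (prefixSum f q ≤_) Σ<a≡0 (prefixSum-mono f q≤a))))

    rest : ℕ → ℕ
    rest j = f j ∸ pairCount a b j

    f≡rest+pair : ∀ j → f j ≡ rest j + pairCount a b j
    f≡rest+pair j = sym (m∸n+n≡m pair≤f)
      where
      pair≤f : pairCount a b j ≤ f j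
      pair≤f with j ≟ a | j ≟ b
      ... | yes refl | _ = subst (_≤ f j) (sym (pairCount-a a≢b)) 1≤f[a]
      ... | no _ | yes refl = subst (_≤ f j) (sym (pairCount-b a≢b)) 1≤f[b]
      ... | no j≢a | no j≢b = subst (_≤ f j) (sym (pairCount-other j≢a j≢b)) z≤n

    -- A position j ∉ {a, b} with f j > T would lie after both a and b, and then the
    -- prefix sum through j would exceed (T + 2) + (T + 1) > total.
    f≤T-off-pair : ∀ j → j < n → j ≢ a → j ≢ b → f j ≤ T
    f≤T-off-pair j j<n j≢a j≢b with f j ≤? T
    ... | yes f[j]≤T = f[j]≤T
    ... | no f[j]≰T = ⊥-elim (<⇒≱ (subst (_< prefixSum f (suc j)) (sym total) too-big) (prefixSum-mono f j<n))
      where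
      1+T≤f[j] : suc T ≤ f j
      1+T≤f[j] = ≰⇒> f[j]≰T
      a<j : a < j
      a<j = ≤∧≢⇒< (crossing-≤ f Σ<a<1 (≤-trans (s≤s z≤n) (≤-trans 1+T≤f[j] (m≤n+m (f j) (prefixSum f j)))))
                  (≢-sym j≢a)
      b<j : b < j
      b<j = ≤∧≢⇒< (crossing-≤ f Σ<b<2+T (+-mono-≤ (≤-trans 1≤Σ≤a (prefixSum-mono f a<j)) 1+T≤f[j]))
                  (≢-sym j≢b)
      too-big : suc T + suc T < prefixSum f (suc j)
      too-big = +-mono-≤ (≤-trans 2+T≤Σ≤b (prefixSum-mono f b<j)) 1+T≤f[j]

    rest≤T-on-pair : ∀ j → j < n → pairCount a b j ≡ 1 → rest j ≤ T
    rest≤T-on-pair j j<n pair≡1 = ≤-pred (subst (_≤ suc T)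
      (trans (f≡rest+pair j) (trans (cong (rest j +_) pair≡1) (+-comm (rest j) 1))) (f≤T j j<n))

    rest≤T : ∀ j → j < n → rest j ≤ T
    rest≤T j j<n with j ≟ a | j ≟ b
    ... | yes refl | _ = rest≤T-on-pair j j<n (pairCount-a a≢b)
    ... | no _ | yes refl = rest≤T-on-pair j j<n (pairCount-b a≢b)
    ... | no j≢a | no j≢b = ≤-trans (m∸n≤m (f j) (pairCount a b j)) (f≤T-off-pair j j<n j≢a j≢b)

    Σf≡Σrest+reached : ∀ m → prefixSum f m ≡ prefixSum rest m + (reached (suc a) m + reached (suc b) m)
    Σf≡Σrest+reached = prefixSum-+pairCount f rest a b f≡rest+pair

    rest-ineqs : Ineqsℕ n p q T rest
    rest-ineqs = ineqsℕ rest≤T total′ prefix≤′ prefix≥′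
      where
      total′ : prefixSum rest n ≡ T + T
      total′ = +-cancelʳ-≡ 2 (prefixSum rest n) (T + T) (begin
        prefixSum rest n + 2
          ≡⟨ cong (prefixSum rest n +_) (sym (cong₂ _+_ (reached-yes {suc a} a<n) (reached-yes {suc b} b<n))) ⟩
        prefixSum rest n + (reached (suc a) n + reached (suc b) n)
          ≡⟨ sym (Σf≡Σrest+reached n) ⟩
        prefixSum f n
          ≡⟨ total ⟩
        suc T + suc T
          ≡⟨ cong suc (+-suc T T) ⟩
        2 + (T + T)
          ≡⟨ +-comm 2 (T + T) ⟩
        T + T + 2 ∎)
        where open ≡-Reasoning
      prefix≤′ : prefixSum rest p ≤ T
      prefix≤′ with a <? p
      ... | yes a<p = ≤-pred (≤-trans (≤-reflexive (+-comm 1 (prefixSum rest p)))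
              (≤-trans (+-monoʳ-≤ (prefixSum rest p) (≤-trans (≤-reflexive (sym (reached-yes {suc a} a<p))) (m≤m+n _ _)))
              (≤-trans (≤-reflexive (sym (Σf≡Σrest+reached p))) prefix≤)))
      ... | no a≮p = ≤-trans (≤-trans (m≤m+n (prefixSum rest p) _) (≤-reflexive (sym (Σf≡Σrest+reached p))))
              (≤-trans (subst (prefixSum f p ≤_) Σ<a≡0 (prefixSum-mono f (≮⇒≥ a≮p))) z≤n)
      prefix≥′ : T ≤ prefixSum rest q
      prefix≥′ with b <? q
      ... | yes b<q = +-cancelʳ-≤ 2 T (prefixSum rest q) (≤-trans (≤-reflexive (+-comm T 2))
              (≤-trans (≤-trans 2+T≤Σ≤b (prefixSum-mono f b<q)) (≤-trans (≤-reflexive (Σf≡Σrest+reached q))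
                (+-monoʳ-≤ (prefixSum rest q) (+-mono-≤ (reached≤1 (suc a) q) (≤-reflexive (reached-yes {suc b} b<q)))))))
      ... | no b≮q = ≤-pred (≤-trans prefix≥ (≤-reflexive (trans (Σf≡Σrest+reached q)
              (trans (cong (prefixSum rest q +_) (cong₂ _+_ (reached-yes {suc a} a<q) (reached-no {suc b} (s≤s (≮⇒≥ b≮q)))))
                (+-comm (prefixSum rest q) 1)))))

  peel : ∀ {n p q T f} → Ineqsℕ n p q (suc T) f → Decomposition n p q T f
  peel h = decomposition a b a<b b<n p≤b a<q rest rest-ineqs f≡rest+pair
    where open Peel h

module Sufficiency where

  open import Defs
  open IntegerEmbedding
  open LinearCombinations
  open IndicatorVectors using (lookup-indicator; oneOf; oneOf-split)
  open PrefixSums using (≤-prefixSum)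
  open GreedyDecomposition
  open LatticePathBases using (isBasis; ∈-bases⁺)
  open import Data.Nat as ℕ using (ℕ; zero; suc; z≤n; s≤s)
  import Data.Nat.Properties as ℕP
  open import Data.Integer as ℤ using (ℤ)
  open import Data.Rational using (ℚ; 0ℚ; 1ℚ; _+_; _*_; _≤_)
  open import Data.Rational.Properties
  open import Data.Rational.Solver
  open import Data.Fin using (Fin; toℕ)
  open import Data.Fin.Properties using (toℕ<n)
  open import Data.Vec using (Vec; lookup; zipWith; replicate; tabulate)
  open import Data.Vec.Properties using (lookup-map; lookup-zipWith; lookup-replicate; lookup∘tabulate)
  open import Data.List as L using (List; []; _∷_; length; map)
  open import Data.List.Properties using (length-replicate)
  open import Data.List.Relation.Unary.All using (All; []; _∷_)
  open import Data.List.Relation.Unary.Any using (here; there)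
  open import Data.List.Membership.Propositional using (_∈_)
  open import Data.List.Membership.Propositional.Properties using (∈-map⁺)
  open import Data.Product using (_,_)
  open import Relation.Binary.PropositionalEquality
  open +-*-Solver

  addAt : ∀ {A : Set} {v : A} {vs : List A} → v ∈ vs → List ℚ → List ℚ
  addAt (here _) (c ∷ cs) = (1ℚ + c) ∷ cs
  addAt (there p) (c ∷ cs) = c ∷ addAt p cs
  addAt _ [] = []

  length-addAt : ∀ {A : Set} {v : A} {vs} (p : v ∈ vs) c → length (addAt p c) ≡ length c
  length-addAt (here _) (c ∷ cs) = refl
  length-addAt (there p) (c ∷ cs) = cong suc (length-addAt p cs)
  length-addAt (here _) [] = refl
  length-addAt (there p) [] = refl

  sumℚ-addAt : ∀ {A : Set} {v : A} {vs} (p : v ∈ vs) c → length c ≡ length vs → sumℚ (addAt p c) ≡ 1ℚ + sumℚ c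
  sumℚ-addAt (here _) (c ∷ cs) _ = +-assoc 1ℚ c (sumℚ cs)
  sumℚ-addAt (there p) (c ∷ cs) e = trans (cong (c +_) (sumℚ-addAt p cs (ℕP.suc-injective e)))
    (solve 2 (λ c s → c :+ (con 1ℚ :+ s) := con 1ℚ :+ (c :+ s)) refl c (sumℚ cs))

  0≤addAt : ∀ {A : Set} {v : A} {vs} (p : v ∈ vs) {c} → All (0ℚ ≤_) c → All (0ℚ ≤_) (addAt p c)
  0≤addAt (here _) (0≤c ∷ 0≤cs) = +-mono-≤ (fromℕ-mono-≤ {0} {1} z≤n) 0≤c ∷ 0≤cs
  0≤addAt (there p) (0≤c ∷ 0≤cs) = 0≤c ∷ 0≤addAt p 0≤cs
  0≤addAt (here _) [] = []
  0≤addAt (there p) [] = []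

  weightedSum-addAt : ∀ {A : Set} (F : A → ℚ) {v vs} (p : v ∈ vs) c → length c ≡ length vs →
    weightedSum (addAt p c) (map F vs) ≡ F v + weightedSum c (map F vs)
  weightedSum-addAt F (here refl) (c ∷ cs) _ =
    solve 3 (λ c y r → (con 1ℚ :+ c) :* y :+ r := y :+ (c :* y :+ r)) refl c (F _) _
  weightedSum-addAt F {v} (there {x = w} p) (c ∷ cs) e
    rewrite weightedSum-addAt F p cs (ℕP.suc-injective e) =
    solve 3 (λ x y r → x :+ (y :+ r) := y :+ (x :+ r)) refl (c * F w) (F v) _

  lincomb-addAt : ∀ {n} {v : Vec ℚ n} {vs} (p : v ∈ vs) c → length c ≡ length vs →
    lincomb (addAt p c) vs ≡ zipWith _+_ v (lincomb c vs)
  lincomb-addAt {v = v} {vs} p c e = lookup-ext λ i → begin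
    lookup (lincomb (addAt p c) vs) i                          ≡⟨ lookup-lincomb i (addAt p c) vs ⟩
    weightedSum (addAt p c) (map (λ w → lookup w i) vs)        ≡⟨ weightedSum-addAt (λ w → lookup w i) p c e ⟩
    lookup v i + weightedSum c (map (λ w → lookup w i) vs)    ≡⟨ cong (lookup v i +_) (sym (lookup-lincomb i c vs)) ⟩
    lookup v i + lookup (lincomb c vs) i                      ≡⟨ sym (lookup-zipWith _+_ i v (lincomb c vs)) ⟩
    lookup (zipWith _+_ v (lincomb c vs)) i                   ∎
    where open ≡-Reasoning

  weightedSum-0 : ∀ m ys → weightedSum (L.replicate m 0ℚ) ys ≡ 0ℚ
  weightedSum-0 zero ys = refl
  weightedSum-0 (suc m) [] = refl
  weightedSum-0 (suc m) (y ∷ ys) = cong₂ _+_ (*-zeroˡ y) (weightedSum-0 m ys)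

  sumℚ-0 : ∀ m → sumℚ (L.replicate m 0ℚ) ≡ 0ℚ
  sumℚ-0 zero = refl
  sumℚ-0 (suc m) = cong (0ℚ +_) (sumℚ-0 m)

  lincomb-0 : ∀ {n} m (vs : List (Vec ℚ n)) → lincomb (L.replicate m 0ℚ) vs ≡ replicate n 0ℚ
  lincomb-0 m vs = lincomb≡0 (L.replicate m 0ℚ) vs λ i → weightedSum-0 m _

  0≤replicate : ∀ m → All (0ℚ ≤_) (L.replicate m 0ℚ)
  0≤replicate zero = []
  0≤replicate (suc m) = ≤-refl ∷ 0≤replicate m

  fromFun : ∀ n → (ℕ → ℕ) → Vec ℤ n
  fromFun n f = tabulate (λ i → ℤ.+ f (toℕ i))

  lookup-fromFun : ∀ n f (i : Fin n) → lookup (toℚvec (fromFun n f)) i ≡ fromℕ (f (toℕ i))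
  lookup-fromFun n f i = trans (lookup-map i fromℤ (fromFun n f)) (cong fromℤ (lookup∘tabulate _ i))

  module _ (n p q : ℕ) (q<n : q ℕ.< n) where

    private
      vs = polytopeLPM n (1 , suc p) (q , n)

    -- Induction on T: each step of the greedy decomposition contributes one vertex e_{a+1,b+1}.
    ineqsℕ⇒inDilate : ∀ T f → Ineqsℕ n p q T f → InDilate vs T (fromFun n f)
    ineqsℕ⇒inDilate zero f h =
      L.replicate (length vs) 0ℚ , length-replicate (length vs) , 0≤replicate (length vs) , sumℚ-0 (length vs) ,
      trans (lincomb-0 (length vs) vs) (lookup-ext λ i →
        trans (lookup-replicate i 0ℚ) (sym (trans (lookup-fromFun n f i) (cong fromℕ (f≡0 i)))))
      where
      f≡0 : ∀ (i : Fin n) → f (toℕ i) ≡ 0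
      f≡0 i = ℕP.n≤0⇒n≡0 (ℕP.≤-trans (≤-prefixSum f (toℕ<n i)) (ℕP.≤-reflexive (Ineqsℕ.total h)))
    ineqsℕ⇒inDilate (suc T) f h with peel h
    ... | decomposition a b a<b b<n p≤b a<q rest rest-ineqs f≡rest+pair
      with ineqsℕ⇒inDilate T rest rest-ineqs
    ... | c , |c| , 0≤c , Σc , x≡ =
      addAt e∈vs c , trans (length-addAt e∈vs c) |c| , 0≤addAt e∈vs 0≤c ,
      trans (sumℚ-addAt e∈vs c |c|) (trans (cong (1ℚ +_) Σc) (sym (fromℕ-+ 1 T))) ,
      trans (lincomb-addAt e∈vs c |c|) (trans (cong (zipWith _+_ e) x≡) (lookup-ext e+rest≡f))
      where
      e = indicator n (suc a , suc b)

      e∈vs : e ∈ vs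
      e∈vs = ∈-map⁺ (indicator n) (∈-bases⁺ (isBasis (s≤s z≤n) (s≤s a<b) b<n (s≤s p≤b) a<q))

      e+rest≡f : ∀ i → lookup (zipWith _+_ e (toℚvec (fromFun n rest))) i ≡ lookup (toℚvec (fromFun n f)) i
      e+rest≡f i = begin
        lookup (zipWith _+_ e (toℚvec (fromFun n rest))) i
          ≡⟨ lookup-zipWith _+_ i e (toℚvec (fromFun n rest)) ⟩
        lookup e i + lookup (toℚvec (fromFun n rest)) i
          ≡⟨ cong₂ _+_ (lookup-indicator n (suc a) (suc b) i) (lookup-fromFun n rest i) ⟩
        fromℕ (oneOf a b j′) + fromℕ (rest j′)
          ≡⟨ cong (λ k → fromℕ k + fromℕ (rest j′)) (oneOf-split j′ (ℕP.<⇒≢ a<b)) ⟩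
        fromℕ (pairCount a b j′) + fromℕ (rest j′)
          ≡⟨ +-comm (fromℕ (pairCount a b j′)) (fromℕ (rest j′)) ⟩
        fromℕ (rest j′) + fromℕ (pairCount a b j′)
          ≡⟨ sym (fromℕ-+ (rest j′) (pairCount a b j′)) ⟩
        fromℕ (rest j′ ℕ.+ pairCount a b j′)
          ≡⟨ cong fromℕ (sym (f≡rest+pair j′)) ⟩
        fromℕ (f j′)
          ≡⟨ sym (lookup-fromFun n f i) ⟩
        lookup (toℚvec (fromFun n f)) i ∎
        where
        open ≡-Reasoning
        j′ = toℕ i

module LatticePoints where

  open import Defs
  open PrefixSums
  open LinearCombinations using (lookup-ext)
  open LatticePointInequalities
  open GreedyDecomposition using (Ineqsℕ; ineqsℕ)
  open Necessity using (inDilate⇒ineqs)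
  open Sufficiency using (fromFun; ineqsℕ⇒inDilate)
  open import Data.Nat as ℕ using (ℕ; zero; suc)
  import Data.Nat.Properties as ℕP
  open import Data.Integer as ℤ using (ℤ; +_; ∣_∣)
  import Data.Integer.Properties as ℤP
  open import Data.Fin using (Fin; zero; suc; toℕ; fromℕ<)
  open import Data.Fin.Properties using (toℕ-fromℕ<)
  open import Data.Vec using (Vec; []; _∷_; lookup)
  open import Data.Vec.Properties using (lookup∘tabulate)
  open import Function.Bundles using (_⇔_; mk⇔)
  open import Data.Product using (_,_)
  open import Relation.Binary.PropositionalEquality
  open import Function using (_∘_)

  lookupOr0 : ∀ {n} → Vec ℤ n → ℕ → ℤ
  lookupOr0 [] j = + 0
  lookupOr0 (x ∷ xs) zero = x
  lookupOr0 (x ∷ xs) (suc j) = lookupOr0 xs j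

  lookupOr0-toℕ : ∀ {n} (x : Vec ℤ n) (i : Fin n) → lookupOr0 x (toℕ i) ≡ lookup x i
  lookupOr0-toℕ (y ∷ x) zero = refl
  lookupOr0-toℕ (y ∷ x) (suc i) = lookupOr0-toℕ x i

  lookupOr0-fromℕ< : ∀ {n} (x : Vec ℤ n) {j} (j<n : j ℕ.< n) → lookupOr0 x j ≡ lookup x (fromℕ< j<n)
  lookupOr0-fromℕ< x {j} j<n = trans (cong (lookupOr0 x) (sym (toℕ-fromℕ< j<n))) (lookupOr0-toℕ x (fromℕ< j<n))

  -- x as a weight sequence; meaningful for x ≥ 0, and 0 beyond the last coordinate
  toFun : ∀ {n} → Vec ℤ n → ℕ → ℕ
  toFun x j = ∣ lookupOr0 x j ∣

  prefixSumℤ≡prefixSum : ∀ {n} m (x : Vec ℤ n) → (∀ i → + 0 ℤ.≤ lookup x i) →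
    prefixSumℤ m x ≡ + prefixSum (toFun x) m
  prefixSumℤ≡prefixSum zero x 0≤x = refl
  prefixSumℤ≡prefixSum (suc m) [] 0≤x = cong +_ (sym (prefixSum-0 (suc m)))
  prefixSumℤ≡prefixSum (suc m) (y ∷ x) 0≤x = begin
    y ℤ.+ prefixSumℤ m x
      ≡⟨ cong₂ ℤ._+_ (sym (ℤP.0≤i⇒+∣i∣≡i (0≤x zero))) (prefixSumℤ≡prefixSum m x (0≤x ∘ suc)) ⟩
    + (∣ y ∣ ℕ.+ prefixSum (toFun x) m)
      ≡⟨ cong +_ (sym (prefixSum-suc (toFun (y ∷ x)) m)) ⟩
    + prefixSum (toFun (y ∷ x)) (suc m) ∎
    where open ≡-Reasoning

  fromFun-toFun : ∀ {n} (x : Vec ℤ n) → (∀ i → + 0 ℤ.≤ lookup x i) → fromFun n (toFun x) ≡ x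
  fromFun-toFun x 0≤x = lookup-ext λ i → trans (lookup∘tabulate _ i)
    (trans (cong (+_ ∘ ∣_∣) (lookupOr0-toℕ x i)) (ℤP.0≤i⇒+∣i∣≡i (0≤x i)))

  ineqs⇒ineqsℕ : ∀ {n p q t} (x : Vec ℤ n) → Ineqs n p q t x → Ineqsℕ n p q t (toFun x)
  ineqs⇒ineqsℕ {n} {p} {q} {t} x (ineqs 0≤x x≤t total prefix≤ prefix≥) = ineqsℕ f≤t
    (ℤP.+-injective (trans (sym (prefixSumℤ≡prefixSum n x 0≤x)) total))
    (ℤP.drop‿+≤+ (subst (ℤ._≤ + t) (prefixSumℤ≡prefixSum p x 0≤x) prefix≤))
    (ℤP.drop‿+≤+ (subst (+ t ℤ.≤_) (prefixSumℤ≡prefixSum q x 0≤x) prefix≥))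
    where
    f≤t : ∀ j → j ℕ.< n → toFun x j ℕ.≤ t
    f≤t j j<n = ℤP.drop‿+≤+ (subst (ℤ._≤ + t) x[j]≡ (x≤t (fromℕ< j<n)))
      where
      x[j]≡ : lookup x (fromℕ< j<n) ≡ + toFun x j
      x[j]≡ = trans (sym (lookupOr0-fromℕ< x j<n))
        (sym (ℤP.0≤i⇒+∣i∣≡i (subst (+ 0 ℤ.≤_) (sym (lookupOr0-fromℕ< x j<n)) (0≤x (fromℕ< j<n)))))

  inDilate⇔ineqs : ∀ n p q → p ℕ.≤ n → q ℕ.< n → ∀ t x →
    InDilate (polytopeLPM n (1 , suc p) (q , n)) t x ⇔ Ineqs n p q t x
  inDilate⇔ineqs n p q p≤n q<n t x = mk⇔
    (inDilate⇒ineqs n (suc p) q t x q<n p q ℕP.≤-refl p≤n ℕP.≤-refl (ℕP.<⇒≤ q<n))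
    (λ h → subst (InDilate _ t) (fromFun-toFun x (Ineqs.0≤x h))
      (ineqsℕ⇒inDilate n p q q<n t (toFun x) (ineqs⇒ineqsℕ x h)))

module Mirror where

  open PrefixSums
  open LinearCombinations using (lookup-ext)
  open LatticePoints using (lookupOr0-toℕ; lookupOr0-fromℕ<; toFun)
  open import Data.Nat as ℕ using (ℕ; zero; suc; _∸_)
  import Data.Nat.Properties as ℕP
  open import Data.Integer using (ℤ; ∣_∣)
  open import Data.Fin using (toℕ; fromℕ<; opposite)
  open import Data.Fin.Properties using (toℕ-fromℕ<; opposite-prop; opposite-involutive)
  open import Data.Vec using (Vec; lookup; tabulate)
  open import Data.Vec.Properties using (lookup∘tabulate)
  open import Relation.Binary.PropositionalEquality
  open import Function using (_∘_)

  mirror : ∀ {n} → Vec ℤ n → Vec ℤ n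
  mirror x = tabulate (lookup x ∘ opposite)

  lookup-mirror : ∀ {n} (x : Vec ℤ n) i → lookup (mirror x) i ≡ lookup x (opposite i)
  lookup-mirror x i = lookup∘tabulate _ i

  mirror-involutive : ∀ {n} (x : Vec ℤ n) → mirror (mirror x) ≡ x
  mirror-involutive x = lookup-ext λ i →
    trans (lookup-mirror (mirror x) i) (trans (lookup-mirror x (opposite i)) (cong (lookup x) (opposite-involutive i)))

  mirror-injective : ∀ {n} {x y : Vec ℤ n} → mirror x ≡ mirror y → x ≡ y
  mirror-injective {x = x} {y} e = trans (sym (mirror-involutive x)) (trans (cong mirror e) (mirror-involutive y))

  toFun-mirror : ∀ {n} (x : Vec ℤ n) {j} → j ℕ.< n → toFun (mirror x) j ≡ toFun x (n ∸ suc j)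
  toFun-mirror {n} x {j} j<n = cong ∣_∣ (begin
    lookupOr0 (mirror x) j               ≡⟨ lookupOr0-fromℕ< (mirror x) j<n ⟩
    lookup (mirror x) i                  ≡⟨ lookup-mirror x i ⟩
    lookup x (opposite i)                ≡⟨ sym (lookupOr0-toℕ x (opposite i)) ⟩
    lookupOr0 x (toℕ (opposite i))       ≡⟨ cong (lookupOr0 x) (trans (opposite-prop i) (cong (λ k → n ∸ suc k) (toℕ-fromℕ< j<n))) ⟩
    lookupOr0 x (n ∸ suc j)              ∎)
    where
    open ≡-Reasoning
    open LatticePoints using (lookupOr0)
    i = fromℕ< j<n

  -- the first m coordinates of mirror x are the last m coordinates of x
  prefixSum-mirror : ∀ {n} (x : Vec ℤ n) m → m ℕ.≤ n →
    prefixSum (toFun (mirror x)) m ℕ.+ prefixSum (toFun x) (n ∸ m) ≡ prefixSum (toFun x) n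
  prefixSum-mirror x zero _ = refl
  prefixSum-mirror {n} x (suc m) m<n = begin
    (prefixSum g m ℕ.+ g m) ℕ.+ prefixSum f (n ∸ suc m)
      ≡⟨ ℕP.+-assoc (prefixSum g m) (g m) _ ⟩
    prefixSum g m ℕ.+ (g m ℕ.+ prefixSum f (n ∸ suc m))
      ≡⟨ cong (λ k → prefixSum g m ℕ.+ (k ℕ.+ prefixSum f (n ∸ suc m))) (toFun-mirror x m<n) ⟩
    prefixSum g m ℕ.+ (f (n ∸ suc m) ℕ.+ prefixSum f (n ∸ suc m))
      ≡⟨ cong (prefixSum g m ℕ.+_) (ℕP.+-comm (f (n ∸ suc m)) _) ⟩
    prefixSum g m ℕ.+ prefixSum f (suc (n ∸ suc m))
      ≡⟨ cong (λ k → prefixSum g m ℕ.+ prefixSum f k) (sym (ℕP.+-∸-assoc 1 m<n)) ⟩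
    prefixSum g m ℕ.+ prefixSum f (n ∸ m)
      ≡⟨ prefixSum-mirror x m (ℕP.<⇒≤ m<n) ⟩
    prefixSum f n ∎
    where
    open ≡-Reasoning
    f = toFun x
    g = toFun (mirror x)

module Counting where

  open PrefixSums
  open LatticePointInequalities
  open GreedyDecomposition using (Ineqsℕ)
  open LatticePoints using (toFun; prefixSumℤ≡prefixSum; ineqs⇒ineqsℕ)
  open Mirror
  open import Data.Nat as ℕ using (ℕ; zero; suc; z≤n; _∸_; _+_)
  import Data.Nat.Properties as ℕP
  open import Data.Integer as ℤ using (ℤ; +_)
  import Data.Integer.Properties as ℤP
  open import Data.Fin using (zero; opposite)
  open import Data.Vec using (Vec; _∷_; lookup)
  open import Data.List using (List; []; _∷_; length; filter; map)
  open import Data.List.Properties using (length-map)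
  open import Data.List.Relation.Unary.Unique.Propositional using (Unique)
  import Data.List.Relation.Unary.Unique.Propositional.Properties as Unique
  open import Data.List.Membership.Propositional using (_∈_)
  open import Data.List.Membership.Propositional.Properties using (∈-filter⁺; ∈-filter⁻; ∈-map⁺; ∈-map⁻)
  open import Data.List.Membership.Propositional.Properties.WithK using (unique∧set⇒bag)
  open import Data.List.Relation.Binary.BagAndSetEquality using (∼bag⇒↭)
  open import Data.List.Relation.Binary.Permutation.Propositional.Properties using (↭-length)
  open import Data.List.Relation.Unary.Any using (here; there)
  open import Data.Product using (_,_)
  open import Data.Sum using (_⊎_; inj₁; inj₂)
  open import Data.Empty using (⊥-elim)
  open import Relation.Nullary using (yes; no)
  open import Relation.Unary using (Decidable)
  open import Relation.Unary.Properties using (_∩?_)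
  open import Function.Bundles using (_⇔_; mk⇔; Equivalence)
  open import Function using (_∘_)
  open import Relation.Binary.PropositionalEquality

  unique-length : ∀ {A : Set} {xs ys : List A} → Unique xs → Unique ys →
    (∀ {x} → x ∈ xs → x ∈ ys) → (∀ {x} → x ∈ ys → x ∈ xs) → length xs ≡ length ys
  unique-length uxs uys xs⊆ys ys⊆xs = ↭-length (∼bag⇒↭ (unique∧set⇒bag uxs uys (mk⇔ xs⊆ys ys⊆xs)))

  length-filter-∩ : ∀ {A : Set} {P Q : A → Set} (P? : Decidable P) (Q? : Decidable Q) xs →
    (∀ {x} → x ∈ xs → P x ⊎ Q x) →
    length (filter (P? ∩? Q?) xs) + length xs ≡ length (filter P? xs) + length (filter Q? xs)
  length-filter-∩ P? Q? [] _ = refl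
  length-filter-∩ P? Q? (x ∷ xs) P∪Q with P? x | Q? x | length-filter-∩ P? Q? xs (P∪Q ∘ there)
  ... | yes _ | yes _ | ih = cong suc (trans (ℕP.+-suc _ _) (trans (cong suc ih) (sym (ℕP.+-suc _ _))))
  ... | yes _ | no _ | ih = trans (ℕP.+-suc _ _) (cong suc ih)
  ... | no _ | yes _ | ih = trans (ℕP.+-suc _ _) (trans (cong suc ih) (sym (ℕP.+-suc _ _)))
  ... | no ¬px | no ¬qx | _ with P∪Q (here refl)
  ...   | inj₁ px = ⊥-elim (¬px px)
  ...   | inj₂ qx = ⊥-elim (¬qx qx)

  module _ {N : ℕ} (t : ℕ) where

    Prefix≤ : ℕ → Vec ℤ N → Set
    Prefix≤ p x = prefixSumℤ p x ℤ.≤ + t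

    Prefix≥ : ℕ → Vec ℤ N → Set
    Prefix≥ q x = + t ℤ.≤ prefixSumℤ q x

    record InHypersimplex (x : Vec ℤ N) : Set where
      constructor inHypersimplex
      field
        0≤x : ∀ i → + 0 ℤ.≤ lookup x i
        x≤t : ∀ i → lookup x i ℤ.≤ + t
        total : prefixSumℤ N x ≡ + (t + t)

    ineqs⇒inHypersimplex : ∀ {p q x} → Ineqs N p q t x → InHypersimplex x
    ineqs⇒inHypersimplex (ineqs 0≤x x≤t total _ _) = inHypersimplex 0≤x x≤t total

    inHypersimplex⇒ineqs : ∀ {p q x} → InHypersimplex x → Prefix≤ p x → Prefix≥ q x → Ineqs N p q t x
    inHypersimplex⇒ineqs (inHypersimplex 0≤x x≤t total) = ineqs 0≤x x≤t total

    prefixSumℤ-mono : ∀ {x m m'} → InHypersimplex x → m ℕ.≤ m' → prefixSumℤ m x ℤ.≤ prefixSumℤ m' x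
    prefixSumℤ-mono {x} {m} {m'} h m≤m' = subst₂ ℤ._≤_
      (sym (prefixSumℤ≡prefixSum m x (InHypersimplex.0≤x h))) (sym (prefixSumℤ≡prefixSum m' x (InHypersimplex.0≤x h)))
      (ℤ.+≤+ (prefixSum-mono (toFun x) m≤m'))

    prefix≤⊎prefix≥ : ∀ {x p q} → InHypersimplex x → p ℕ.≤ q → Prefix≤ p x ⊎ Prefix≥ q x
    prefix≤⊎prefix≥ {x} {p} h p≤q with prefixSumℤ p x ℤ.≤? + t
    ... | yes ≤t = inj₁ ≤t
    ... | no ≰t = inj₂ (ℤP.≤-trans (ℤP.<⇒≤ (ℤP.≰⇒> ≰t)) (prefixSumℤ-mono h p≤q))

    mirror-inHypersimplex : ∀ {x} → InHypersimplex x → InHypersimplex (mirror x)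
    mirror-inHypersimplex {x} (inHypersimplex 0≤x x≤t total) = inHypersimplex 0≤x′
      (λ i → subst (ℤ._≤ + t) (sym (lookup-mirror x i)) (x≤t (opposite i)))
      (trans (prefixSumℤ≡prefixSum N (mirror x) 0≤x′) (trans (cong +_ same-total) (trans (sym (prefixSumℤ≡prefixSum N x 0≤x)) total)))
      where
      0≤x′ : ∀ i → + 0 ℤ.≤ lookup (mirror x) i
      0≤x′ i = subst (+ 0 ℤ.≤_) (sym (lookup-mirror x i)) (0≤x (opposite i))
      same-total : prefixSum (toFun (mirror x)) N ≡ prefixSum (toFun x) N
      same-total = trans (sym (ℕP.+-identityʳ _))
        (trans (cong (λ m → prefixSum (toFun (mirror x)) N + prefixSum (toFun x) m) (sym (ℕP.n∸n≡0 N)))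
          (prefixSum-mirror x N ℕP.≤-refl))

    module _ {x : Vec ℤ N} (h : InHypersimplex x) (k : ℕ) (k≤N : k ℕ.≤ N) where

      private
        f = toFun x
        g = toFun (mirror x)
        0≤x = InHypersimplex.0≤x h
        0≤mirror = InHypersimplex.0≤x (mirror-inHypersimplex h)

        split : prefixSum g k + prefixSum f (N ∸ k) ≡ t + t
        split = trans (prefixSum-mirror x k k≤N)
          (ℤP.+-injective (trans (sym (prefixSumℤ≡prefixSum N x 0≤x)) (InHypersimplex.total h)))

      prefix≥⇒mirror-prefix≤ : Prefix≥ (N ∸ k) x → Prefix≤ k (mirror x)
      prefix≥⇒mirror-prefix≤ ≥t = subst (ℤ._≤ + t) (sym (prefixSumℤ≡prefixSum k (mirror x) 0≤mirror))
        (ℤ.+≤+ (ℕP.+-cancelʳ-≤ (prefixSum f (N ∸ k)) (prefixSum g k) t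
          (ℕP.≤-trans (ℕP.≤-reflexive split)
            (ℕP.+-monoʳ-≤ t (ℤP.drop‿+≤+ (subst (+ t ℤ.≤_) (prefixSumℤ≡prefixSum (N ∸ k) x 0≤x) ≥t))))))

      mirror-prefix≤⇒prefix≥ : Prefix≤ k (mirror x) → Prefix≥ (N ∸ k) x
      mirror-prefix≤⇒prefix≥ ≤t = subst (+ t ℤ.≤_) (sym (prefixSumℤ≡prefixSum (N ∸ k) x 0≤x))
        (ℤ.+≤+ (ℕP.+-cancelˡ-≤ (prefixSum g k) t (prefixSum f (N ∸ k))
          (ℕP.≤-trans (ℕP.+-monoˡ-≤ t (ℤP.drop‿+≤+ (subst (ℤ._≤ + t) (prefixSumℤ≡prefixSum k (mirror x) 0≤mirror) ≤t)))
            (ℕP.≤-reflexive (sym split)))))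

  module _ {n : ℕ} (t : ℕ) where

    private
      N = suc n

    prefix≤-1 : ∀ {x : Vec ℤ N} → InHypersimplex t x → Prefix≤ t 1 x
    prefix≤-1 {y ∷ _} h = subst (ℤ._≤ + t) (sym (ℤP.+-identityʳ y)) (InHypersimplex.x≤t h zero)

    -- all but the last coordinate already sum to at least 2t − t
    prefix≥-init : ∀ {x : Vec ℤ N} → InHypersimplex t x → Prefix≥ t n x
    prefix≥-init {x} (inHypersimplex 0≤x x≤t total) = subst (+ t ℤ.≤_) (sym (prefixSumℤ≡prefixSum n x 0≤x))
      (ℤ.+≤+ (ℕP.+-cancelʳ-≤ (toFun x n) t (prefixSum (toFun x) n)
        (ℕP.≤-trans (ℕP.+-monoʳ-≤ t (Ineqsℕ.f≤T weights n ℕP.≤-refl)) (ℕP.≤-reflexive (sym (Ineqsℕ.total weights))))))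
      where
      weights : Ineqsℕ N 0 N t (toFun x)
      weights = ineqs⇒ineqsℕ {N} {0} {N} {t} x
            (ineqs 0≤x x≤t total (ℤ.+≤+ z≤n) (subst (+ t ℤ.≤_) (sym total) (ℤ.+≤+ (ℕP.m≤m+n t t))))

    Prefix≤? : ∀ p → Decidable (Prefix≤ {N} t p)
    Prefix≤? p x = prefixSumℤ p x ℤ.≤? + t

    Prefix≥? : ∀ q → Decidable (Prefix≥ {N} t q)
    Prefix≥? q x = + t ℤ.≤? prefixSumℤ q x

    -- Everything is counted inside the lattice points xsU of t · P_{U_{2,N}} = t · Δ(2, N).
    module _ (xsU : List (Vec ℤ N)) (uniqueU : Unique xsU) (∈U⇔ : ∀ x → (x ∈ xsU) ⇔ Ineqs N 1 n t x) where

      private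
        to = Equivalence.to
        from = Equivalence.from

        ∈U⇒ : ∀ {x} → x ∈ xsU → InHypersimplex t x
        ∈U⇒ {x} x∈ = ineqs⇒inHypersimplex t (to (∈U⇔ x) x∈)

        ⇒∈U : ∀ {x} → InHypersimplex t x → x ∈ xsU
        ⇒∈U h = from (∈U⇔ _) (inHypersimplex⇒ineqs t h (prefix≤-1 h) (prefix≥-init h))

      length-ineqs : ∀ p q xs → Unique xs → (∀ x → (x ∈ xs) ⇔ Ineqs N p q t x) →
        length xs ≡ length (filter (Prefix≤? p ∩? Prefix≥? q) xsU)
      length-ineqs p q xs uniq ∈⇔ = unique-length uniq (Unique.filter⁺ (Prefix≤? p ∩? Prefix≥? q) uniqueU)
        (λ {x} x∈ → let h = to (∈⇔ x) x∈ in
          ∈-filter⁺ (Prefix≤? p ∩? Prefix≥? q) (⇒∈U (ineqs⇒inHypersimplex t h)) (Ineqs.prefix≤ h , Ineqs.prefix≥ h))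
        (λ {x} x∈ → let (x∈U , ≤t , ≥t) = ∈-filter⁻ (Prefix≤? p ∩? Prefix≥? q) {xs = xsU} x∈ in
          from (∈⇔ x) (inHypersimplex⇒ineqs t (∈U⇒ x∈U) ≤t ≥t))

      length-prefix : ∀ p xs → Unique xs → (∀ x → (x ∈ xs) ⇔ Ineqs N p n t x) →
        length xs ≡ length (filter (Prefix≤? p) xsU)
      length-prefix p xs uniq ∈⇔ = unique-length uniq (Unique.filter⁺ (Prefix≤? p) uniqueU)
        (λ {x} x∈ → let h = to (∈⇔ x) x∈ in
          ∈-filter⁺ (Prefix≤? p) (⇒∈U (ineqs⇒inHypersimplex t h)) (Ineqs.prefix≤ h))
        (λ {x} x∈ → let (x∈U , ≤t) = ∈-filter⁻ (Prefix≤? p) {xs = xsU} x∈ in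
          from (∈⇔ x) (inHypersimplex⇒ineqs t (∈U⇒ x∈U) ≤t (prefix≥-init (∈U⇒ x∈U))))

      length-suffix : ∀ k xs → k ℕ.≤ N → Unique xs → (∀ x → (x ∈ xs) ⇔ Ineqs N k n t x) →
        length xs ≡ length (filter (Prefix≥? (N ∸ k)) xsU)
      length-suffix k xs k≤N uniq ∈⇔ = trans
        (unique-length uniq (Unique.map⁺ mirror-injective (Unique.filter⁺ (Prefix≥? (N ∸ k)) uniqueU))
          (λ {x} x∈ → let h = to (∈⇔ x) x∈
                          hm = mirror-inHypersimplex t (ineqs⇒inHypersimplex t h) in
            subst (_∈ map mirror F) (mirror-involutive x)
              (∈-map⁺ mirror (∈-filter⁺ (Prefix≥? (N ∸ k)) (⇒∈U hm)
                (mirror-prefix≤⇒prefix≥ t hm k k≤N (subst (Prefix≤ t k) (sym (mirror-involutive x)) (Ineqs.prefix≤ h))))))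
          (λ {x} x∈ → let (y , y∈ , x≡) = ∈-map⁻ mirror x∈
                          (y∈U , ≥t) = ∈-filter⁻ (Prefix≥? (N ∸ k)) {xs = xsU} y∈
                          hm = mirror-inHypersimplex t (∈U⇒ y∈U) in
            subst (_∈ xs) (sym x≡) (from (∈⇔ (mirror y))
              (inHypersimplex⇒ineqs t hm (prefix≥⇒mirror-prefix≤ t (∈U⇒ y∈U) k k≤N ≥t) (prefix≥-init hm)))))
        (length-map mirror F)
        where F = filter (Prefix≥? (N ∸ k)) xsU

      -- Inclusion–exclusion: for p ≤ q every point of t · Δ(2, N) satisfies one of the two prefix conditions.
      length-inclusion-exclusion : ∀ p k (xsM xs₁ xs₂ : List (Vec ℤ N)) → p ℕ.≤ N ∸ k → k ℕ.≤ N →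
        Unique xsM → Unique xs₁ → Unique xs₂ →
        (∀ x → (x ∈ xsM) ⇔ Ineqs N p (N ∸ k) t x) → (∀ x → (x ∈ xs₁) ⇔ Ineqs N p n t x) →
        (∀ x → (x ∈ xs₂) ⇔ Ineqs N k n t x) →
        length xsM + length xsU ≡ length xs₁ + length xs₂
      length-inclusion-exclusion p k xsM xs₁ xs₂ p≤N∸k k≤N uniqM uniq₁ uniq₂ ∈M ∈₁ ∈₂ = begin
        length xsM + length xsU
          ≡⟨ cong (_+ length xsU) (length-ineqs p (N ∸ k) xsM uniqM ∈M) ⟩
        length (filter (Prefix≤? p ∩? Prefix≥? (N ∸ k)) xsU) + length xsU
          ≡⟨ length-filter-∩ (Prefix≤? p) (Prefix≥? (N ∸ k)) xsU (λ x∈ → prefix≤⊎prefix≥ t (∈U⇒ x∈) p≤N∸k) ⟩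
        length (filter (Prefix≤? p) xsU) + length (filter (Prefix≥? (N ∸ k)) xsU)
          ≡⟨ sym (cong₂ _+_ (length-prefix p xs₁ uniq₁ ∈₁) (length-suffix k xs₂ k≤N uniq₂ ∈₂)) ⟩
        length xs₁ + length xs₂ ∎
        where open ≡-Reasoning

module Rank where

  open import Defs
  open LinearCombinations
  open import Data.Nat as ℕ using (ℕ; zero; suc; z≤n; s≤s)
  import Data.Nat.Properties as ℕP
  open import Data.Rational as ℚ using (ℚ; 0ℚ; 1ℚ; _+_; _*_; -_; 1/_)
  open import Data.Rational.Properties using (_≟_; *-zeroʳ; *-zeroˡ; +-identityˡ; +-assoc; *-inverseˡ)
  open import Data.Rational.Solver
  open import Data.Fin using (Fin)
  open import Data.Vec as V using (Vec; []; _∷_; lookup; zipWith; replicate)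
  open import Data.Vec.Properties using (lookup-zipWith; lookup-map)
  open import Data.List as L using (List; []; _∷_; length; map; _++_)
  open import Data.List.Properties using (length-map; length-++; map-∘; map-++; map-cong; length-replicate)
  open import Data.List.Relation.Unary.All as All using (All; []; _∷_)
  import Data.List.Relation.Unary.All.Properties as All
  open import Data.Product using (Σ; _×_; _,_; proj₂; ∃₂)
  open import Data.Sum using (_⊎_; inj₁; inj₂)
  open import Relation.Nullary using (yes; no)
  open import Relation.Binary.PropositionalEquality
  open +-*-Solver

  LinearlyIndependent : ∀ {n} → List (Vec ℚ n) → Set
  LinearlyIndependent {n} ps = ∀ c → length c ≡ length ps → lincomb c ps ≡ replicate n 0ℚ → All (_≡ 0ℚ) c

  weightedSum-++ : ∀ c₁ c₂ ys₁ ys₂ → length c₁ ≡ length ys₁ →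
    weightedSum (c₁ ++ c₂) (ys₁ ++ ys₂) ≡ weightedSum c₁ ys₁ + weightedSum c₂ ys₂
  weightedSum-++ [] c₂ [] ys₂ _ = sym (+-identityˡ _)
  weightedSum-++ (c ∷ c₁) c₂ (y ∷ ys₁) ys₂ e rewrite weightedSum-++ c₁ c₂ ys₁ ys₂ (ℕP.suc-injective e) =
    sym (+-assoc (c * y) _ _)

  weightedSum-zeros : ∀ c ys → All (_≡ 0ℚ) ys → weightedSum c ys ≡ 0ℚ
  weightedSum-zeros [] ys _ = refl
  weightedSum-zeros (c ∷ cs) [] _ = refl
  weightedSum-zeros (c ∷ cs) (y ∷ ys) (refl ∷ ys≡0) = cong₂ _+_ (*-zeroʳ c) (weightedSum-zeros cs ys ys≡0)

  weightedSum-+* : ∀ {A : Set} c (rs : List A) (F G : A → ℚ) κ →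
    weightedSum c (map (λ r → F r + G r * κ) rs) ≡ weightedSum c (map F rs) + weightedSum c (map G rs) * κ
  weightedSum-+* [] rs F G κ = sym (cong (0ℚ +_) (*-zeroˡ κ))
  weightedSum-+* (c ∷ cs) [] F G κ = sym (cong (0ℚ +_) (*-zeroˡ κ))
  weightedSum-+* (c ∷ cs) (r ∷ rs) F G κ rewrite weightedSum-+* cs rs F G κ =
    solve 6 (λ c f g k a b → c :* (f :+ g :* k) :+ (a :+ b :* k) := (c :* f :+ a) :+ (c :* g :+ b) :* k)
      refl c (F r) (G r) κ (weightedSum cs (map F rs)) (weightedSum cs (map G rs))

  split-length : ∀ {A B : Set} (c : List A) (ys₁ : List B) {m} → length c ≡ length ys₁ ℕ.+ m →
    Σ (List A) λ c₁ → Σ (List A) λ c₂ → c ≡ c₁ ++ c₂ × length c₁ ≡ length ys₁ × length c₂ ≡ m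
  split-length c [] e = [] , c , refl , refl , e
  split-length (x ∷ c) (y ∷ ys₁) e with split-length c ys₁ (ℕP.suc-injective e)
  ... | c₁ , c₂ , refl , |c₁| , |c₂| = x ∷ c₁ , c₂ , refl , cong suc |c₁| , |c₂|

  lincomb-to-front : ∀ {n} c₁ c₀ c₂ (ps : List (Vec ℚ n)) v qs → length c₁ ≡ length ps →
    lincomb (c₁ ++ c₀ ∷ c₂) (ps ++ v ∷ qs) ≡ lincomb (c₀ ∷ c₁ ++ c₂) (v ∷ ps ++ qs)
  lincomb-to-front c₁ c₀ c₂ ps v qs |c₁| = lookup-ext λ i → begin
    lookup (lincomb (c₁ ++ c₀ ∷ c₂) (ps ++ v ∷ qs)) i
      ≡⟨ lookup-lincomb i (c₁ ++ c₀ ∷ c₂) (ps ++ v ∷ qs) ⟩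
    weightedSum (c₁ ++ c₀ ∷ c₂) (map (F i) (ps ++ v ∷ qs))
      ≡⟨ cong (weightedSum (c₁ ++ c₀ ∷ c₂)) (map-++ (F i) ps (v ∷ qs)) ⟩
    weightedSum (c₁ ++ c₀ ∷ c₂) (map (F i) ps ++ map (F i) (v ∷ qs))
      ≡⟨ weightedSum-++ c₁ (c₀ ∷ c₂) (map (F i) ps) _ (|c₁|′ i) ⟩
    weightedSum c₁ (map (F i) ps) + (c₀ * F i v + weightedSum c₂ (map (F i) qs))
      ≡⟨ solve 3 (λ a b c → a :+ (b :+ c) := b :+ (a :+ c)) refl (weightedSum c₁ (map (F i) ps)) (c₀ * F i v) _ ⟩
    c₀ * F i v + (weightedSum c₁ (map (F i) ps) + weightedSum c₂ (map (F i) qs))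
      ≡⟨ cong (c₀ * F i v +_) (sym (weightedSum-++ c₁ c₂ (map (F i) ps) _ (|c₁|′ i))) ⟩
    c₀ * F i v + weightedSum (c₁ ++ c₂) (map (F i) ps ++ map (F i) qs)
      ≡⟨ cong (λ z → c₀ * F i v + weightedSum (c₁ ++ c₂) z) (sym (map-++ (F i) ps qs)) ⟩
    weightedSum (c₀ ∷ c₁ ++ c₂) (map (F i) (v ∷ ps ++ qs))
      ≡⟨ sym (lookup-lincomb i (c₀ ∷ c₁ ++ c₂) (v ∷ ps ++ qs)) ⟩
    lookup (lincomb (c₀ ∷ c₁ ++ c₂) (v ∷ ps ++ qs)) i ∎
    where
    open ≡-Reasoning
    F : ∀ {n} → Fin n → Vec ℚ n → ℚ
    F i w = lookup w i
    |c₁|′ : ∀ i → length c₁ ≡ length (map (F i) ps)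
    |c₁|′ i = trans |c₁| (sym (length-map (F i) ps))

  independent-to-front : ∀ {n} (ps : List (Vec ℚ n)) v qs →
    LinearlyIndependent (ps ++ v ∷ qs) → LinearlyIndependent (v ∷ ps ++ qs)
  independent-to-front ps v qs indep (c₀ ∷ c) |c| e
    with split-length c ps {length qs} (trans (ℕP.suc-injective |c|) (length-++ ps))
  ... | c₁ , c₂ , refl , |c₁| , |c₂| = to-front (indep (c₁ ++ c₀ ∷ c₂) |c′| (trans (lincomb-to-front c₁ c₀ c₂ ps v qs |c₁|) e))
    where
    |c′| : length (c₁ ++ c₀ ∷ c₂) ≡ length (ps ++ v ∷ qs)
    |c′| = trans (length-++ c₁) (trans (cong₂ ℕ._+_ |c₁| (cong suc |c₂|)) (sym (length-++ ps)))
    to-front : All (_≡ 0ℚ) (c₁ ++ c₀ ∷ c₂) → All (_≡ 0ℚ) (c₀ ∷ c₁ ++ c₂)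
    to-front all≡0 with All.++⁻ c₁ all≡0
    ... | c₁≡0 , c₀≡0 ∷ c₂≡0 = c₀≡0 ∷ All.++⁺ c₁≡0 c₂≡0

  lincomb-∷ : ∀ {n} c (ps : List (Vec ℚ (suc n))) →
    lincomb c ps ≡ weightedSum c (map V.head ps) ∷ lincomb c (map V.tail ps)
  lincomb-∷ [] ps = refl
  lincomb-∷ (c ∷ cs) [] = refl
  lincomb-∷ (c ∷ cs) ((h ∷ t) ∷ ps) rewrite lincomb-∷ cs ps = refl

  findPivot : ∀ {n} (ps : List (Vec ℚ (suc n))) →
    All (λ p → V.head p ≡ 0ℚ) ps ⊎ (∃₂ λ qs v → Σ (List (Vec ℚ (suc n))) λ rs → ps ≡ qs ++ v ∷ rs × V.head v ≢ 0ℚ)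
  findPivot [] = inj₁ []
  findPivot (p ∷ ps) with V.head p ≟ 0ℚ
  ... | no p₀≢0 = inj₂ ([] , p , ps , refl , p₀≢0)
  ... | yes p₀≡0 with findPivot ps
  ...   | inj₁ heads≡0 = inj₁ (p₀≡0 ∷ heads≡0)
  ...   | inj₂ (qs , v , rs , refl , v₀≢0) = inj₂ (p ∷ qs , v , rs , refl , v₀≢0)

  independent-tails : ∀ {n} (ps : List (Vec ℚ (suc n))) → All (λ p → V.head p ≡ 0ℚ) ps →
    LinearlyIndependent ps → LinearlyIndependent (map V.tail ps)
  independent-tails ps heads≡0 indep c |c| e = indep c (trans |c| (length-map V.tail ps))
    (trans (lincomb-∷ c ps) (cong₂ _∷_ (weightedSum-zeros c (map V.head ps) (All.map⁺ heads≡0)) e))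

  -- Gaussian elimination of the first coordinate using the pivot v.
  module Eliminate {n} (v : Vec ℚ (suc n)) (v₀≢0 : V.head v ≢ 0ℚ) where

    private
      instance
        v₀-nonZero : ℚ.NonZero (V.head v)
        v₀-nonZero = ℚ.≢-nonZero v₀≢0
      μ = - (1/ V.head v)

    eliminate : Vec ℚ (suc n) → Vec ℚ n
    eliminate r = zipWith _+_ (V.tail r) (V.map (λ y → V.head r * (μ * y)) (V.tail v))

    independent-eliminate : ∀ rs → LinearlyIndependent (v ∷ rs) → LinearlyIndependent (map eliminate rs)
    independent-eliminate rs indep d |d| e =
      proj₂ (All.uncons (indep (c₀ ∷ d) (cong suc (trans |d| (length-map eliminate rs)))
        (trans (lincomb-∷ (c₀ ∷ d) (v ∷ rs)) (cong₂ _∷_ head≡0 tail≡0))))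
      where
      Σh = weightedSum d (map V.head rs)
      c₀ = Σh * μ
      head≡0 : c₀ * V.head v + Σh ≡ 0ℚ
      head≡0 = trans (solve 3 (λ s a h → s :* (:- a) :* h :+ s := :- (s :* (a :* h)) :+ s) refl Σh (1/ V.head v) (V.head v))
        (trans (cong (λ z → - (Σh * z) + Σh) (*-inverseˡ (V.head v))) (solve 1 (λ s → :- (s :* con 1ℚ) :+ s := con 0ℚ) refl Σh))
      tail≡0 : lincomb (c₀ ∷ d) (V.tail v ∷ map V.tail rs) ≡ replicate n 0ℚ
      tail≡0 = lincomb≡0 (c₀ ∷ d) (V.tail v ∷ map V.tail rs) λ j → begin
        c₀ * lookup (V.tail v) j + weightedSum d (map (λ w → lookup w j) (map V.tail rs))
          ≡⟨ cong (λ z → c₀ * lookup (V.tail v) j + weightedSum d z) (sym (map-∘ rs)) ⟩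
        c₀ * lookup (V.tail v) j + weightedSum d (map (λ r → lookup (V.tail r) j) rs)
          ≡⟨ solve 4 (λ s m t a → s :* m :* t :+ a := a :+ s :* (m :* t)) refl Σh μ (lookup (V.tail v) j) _ ⟩
        weightedSum d (map (λ r → lookup (V.tail r) j) rs) + Σh * (μ * lookup (V.tail v) j)
          ≡⟨ sym (weightedSum-+* d rs (λ r → lookup (V.tail r) j) V.head (μ * lookup (V.tail v) j)) ⟩
        weightedSum d (map (λ r → lookup (V.tail r) j + V.head r * (μ * lookup (V.tail v) j)) rs)
          ≡⟨ cong (weightedSum d) (map-cong (λ r → sym (lookup-eliminate r j)) rs) ⟩
        weightedSum d (map (λ r → lookup (eliminate r) j) rs)
          ≡⟨ cong (weightedSum d) (map-∘ rs) ⟩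
        weightedSum d (map (λ w → lookup w j) (map eliminate rs))
          ≡⟨ lincomb≡0⁻ d (map eliminate rs) e j ⟩
        0ℚ ∎
        where
        open ≡-Reasoning
        lookup-eliminate : ∀ r j → lookup (eliminate r) j ≡ lookup (V.tail r) j + V.head r * (μ * lookup (V.tail v) j)
        lookup-eliminate r j = trans (lookup-zipWith _+_ j (V.tail r) _) (cong (lookup (V.tail r) j +_) (lookup-map j _ (V.tail v)))

  independent⇒length≤ : ∀ n (ps : List (Vec ℚ n)) → LinearlyIndependent ps → length ps ℕ.≤ n
  independent⇒length≤ zero [] indep = z≤n
  independent⇒length≤ zero (p ∷ ps) indep
    with indep (1ℚ ∷ L.replicate (length ps) 0ℚ) (cong suc (length-replicate (length ps))) (lookup-ext λ ())
  ... | () ∷ _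
  independent⇒length≤ (suc n) ps indep with findPivot ps
  ... | inj₁ heads≡0 = ℕP.m≤n⇒m≤1+n (subst (ℕ._≤ n) (length-map V.tail ps)
          (independent⇒length≤ n (map V.tail ps) (independent-tails ps heads≡0 indep)))
  ... | inj₂ (qs , v , rs , refl , v₀≢0) = subst (ℕ._≤ suc n) (sym |ps|)
          (s≤s (subst (ℕ._≤ n) (length-map eliminate (qs ++ rs))
            (independent⇒length≤ n _ (independent-eliminate (qs ++ rs) (independent-to-front qs v rs indep)))))
    where
    open Eliminate v v₀≢0
    |ps| : length (qs ++ v ∷ rs) ≡ suc (length (qs ++ rs))
    |ps| = trans (length-++ qs) (trans (ℕP.+-suc (length qs) (length rs)) (cong suc (sym (length-++ qs))))

module Dimension where

  open import Defs
  open LinearCombinations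
  open IndicatorVectors using (lookup-indicator; ≢⇒≡ᵇ-false; ≡ᵇ-refl; prefixSumℚ-indicator)
  open IntegerEmbedding using (fromℕ)
  open Rank
  open LatticePathBases using (IsBasis; isBasis; ∈-bases⁺; ∈-bases⁻; reached-yes)
  open import Data.Bool using (true; false)
  open import Data.Nat as ℕ using (ℕ; zero; suc; z≤n; s≤s; _∸_; _≡ᵇ_)
  import Data.Nat.Properties as ℕP
  open import Data.Rational as ℚ using (ℚ; 0ℚ; 1ℚ; _+_; _*_; -_; ½; 1/_)
  open import Data.Rational.Properties using (_≟_; 1≢0; *-zeroˡ; *-zeroʳ; +-identityˡ; +-identityʳ; *-identityˡ; *-inverseˡ; *-assoc)
  open import Data.Rational.Solver
  open import Data.Vec using (Vec; lookup)
  open import Data.Fin using (Fin; toℕ; fromℕ<)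
  open import Data.Fin.Properties using (toℕ-fromℕ<)
  open import Data.List using (List; []; _∷_; length; map; _++_)
  open import Data.List.Properties using (length-map; length-++)
  open import Data.List.Relation.Unary.All as All using (All; []; _∷_)
  import Data.List.Relation.Unary.All.Properties as All
  open import Data.List.Membership.Propositional using (_∈_)
  open import Data.List.Membership.Propositional.Properties using (∈-map⁺; ∈-map⁻)
  open import Data.List.Relation.Binary.Subset.Propositional using (_⊆_)
  open import Data.Product using (_×_; _,_; proj₁; proj₂; Σ)
  open import Data.Sum using (_⊎_; inj₁; inj₂)
  open import Data.Unit using (⊤)
  open import Data.Empty using (⊥-elim)
  open import Relation.Nullary using (yes; no)
  open import Relation.Binary.PropositionalEquality
  open import Function using (_∘′_)
  open +-*-Solver

  *≡0⇒≡0 : ∀ c x → c * x ≡ 0ℚ → x ≢ 0ℚ → c ≡ 0ℚ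
  *≡0⇒≡0 c x cx≡0 x≢0 with c ≟ 0ℚ
  ... | yes c≡0 = c≡0
  ... | no c≢0 = ⊥-elim (x≢0 (begin
    x                 ≡⟨ sym (*-identityˡ x) ⟩
    1ℚ * x            ≡⟨ cong (_* x) (sym (*-inverseˡ c)) ⟩
    (1/ c) * c * x    ≡⟨ *-assoc (1/ c) c x ⟩
    (1/ c) * (c * x)  ≡⟨ cong ((1/ c) *_) cx≡0 ⟩
    (1/ c) * 0ℚ       ≡⟨ *-zeroʳ (1/ c) ⟩
    0ℚ                ∎))
    where
    open ≡-Reasoning
    instance
      c-nonZero : ℚ.NonZero c
      c-nonZero = ℚ.≢-nonZero c≢0

  independent-∷ : ∀ {n} (j : Fin n) v ws → lookup v j ≢ 0ℚ → All (λ w → lookup w j ≡ 0ℚ) ws →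
    LinearlyIndependent ws → LinearlyIndependent (v ∷ ws)
  independent-∷ j v ws v[j]≢0 ws[j]≡0 indep (c₀ ∷ c) |c| e =
    c₀≡0 ∷ indep c (ℕP.suc-injective |c|) (lincomb≡0 c ws λ i → begin
      weightedSum c (map (λ w → lookup w i) ws)             ≡⟨ sym (+-identityˡ _) ⟩
      0ℚ + weightedSum c (map (λ w → lookup w i) ws)        ≡⟨ cong (_+ _) (sym (trans (cong (_* lookup v i) c₀≡0) (*-zeroˡ (lookup v i)))) ⟩
      c₀ * lookup v i + weightedSum c (map (λ w → lookup w i) ws) ≡⟨ lincomb≡0⁻ (c₀ ∷ c) (v ∷ ws) e i ⟩
      0ℚ ∎)
    where
    open ≡-Reasoning
    c₀≡0 : c₀ ≡ 0ℚ
    c₀≡0 = *≡0⇒≡0 c₀ (lookup v j) (trans (sym (trans (cong (c₀ * lookup v j +_) (weightedSum-zeros c _ (All.map⁺ ws[j]≡0))) (+-identityʳ _)))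
      (lincomb≡0⁻ (c₀ ∷ c) (v ∷ ws) e j)) v[j]≢0

  lookup-indicator-≢ : ∀ {n} (j : Fin n) a b → suc (toℕ j) ≢ a → suc (toℕ j) ≢ b → lookup (indicator n (a , b)) j ≡ 0ℚ
  lookup-indicator-≢ {n} j a b ≢a ≢b
    rewrite lookup-indicator n a b j | ≢⇒≡ᵇ-false ≢a | ≢⇒≡ᵇ-false ≢b = refl

  lookup-indicator-fst : ∀ {n} (j : Fin n) a b → suc (toℕ j) ≡ a → lookup (indicator n (a , b)) j ≡ 1ℚ
  lookup-indicator-fst {n} j _ b refl rewrite lookup-indicator n (suc (toℕ j)) b j | ≡ᵇ-refl (toℕ j) = refl

  lookup-indicator-snd : ∀ {n} (j : Fin n) a b → suc (toℕ j) ≡ b → lookup (indicator n (a , b)) j ≡ 1ℚ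
  lookup-indicator-snd {n} j a _ refl rewrite lookup-indicator n a (suc (toℕ j)) j | ≡ᵇ-refl (toℕ j)
    with suc (toℕ j) ≡ᵇ a
  ... | true = refl
  ... | false = refl

  Avoids : ℕ → List TwoSubset → Set
  Avoids x Bs = All (λ B → x ≢ proj₁ B × x ≢ proj₂ B) Bs

  FreshChain : ℕ → List TwoSubset → List TwoSubset → Set
  FreshChain n [] R = ⊤
  FreshChain n (B ∷ Bs) R =
    (Σ (Fin n) λ j → (suc (toℕ j) ≡ proj₁ B ⊎ suc (toℕ j) ≡ proj₂ B) × Avoids (suc (toℕ j)) (Bs ++ R))
    × FreshChain n Bs R

  independent-chain : ∀ {n} (Bs R : List TwoSubset) → FreshChain n Bs R →
    LinearlyIndependent (map (indicator n) R) → LinearlyIndependent (map (indicator n) (Bs ++ R))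
  independent-chain [] R _ indep = indep
  independent-chain {n} ((a , b) ∷ Bs) R ((j , j∈B , avoids) , chain) indep =
    independent-∷ j (indicator n (a , b)) (map (indicator n) (Bs ++ R)) (≢0 j∈B)
      (All.map⁺ (All.map (λ {B} (≢a , ≢b) → lookup-indicator-≢ j (proj₁ B) (proj₂ B) ≢a ≢b) avoids))
      (independent-chain Bs R chain indep)
    where
    ≢0 : (suc (toℕ j) ≡ a ⊎ suc (toℕ j) ≡ b) → lookup (indicator n (a , b)) j ≢ 0ℚ
    ≢0 (inj₁ ≡a) = 1≢0 ∘′ trans (sym (lookup-indicator-fst j a b ≡a))
    ≢0 (inj₂ ≡b) = 1≢0 ∘′ trans (sym (lookup-indicator-snd j a b ≡b))

  lefts : ℕ → ℕ → ℕ → List TwoSubset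
  lefts q s zero = []
  lefts q s (suc c) = (suc s , q) ∷ lefts q (suc s) c

  rights : ℕ → ℕ → ℕ → List TwoSubset
  rights q s zero = []
  rights q s (suc c) = (q , suc s) ∷ rights q (suc s) c

  triangle : ℕ → List TwoSubset
  triangle r = (suc r , 2 ℕ.+ r) ∷ (suc r , 3 ℕ.+ r) ∷ (2 ℕ.+ r , 3 ℕ.+ r) ∷ []

  All-lefts : ∀ q s c (P : TwoSubset → Set) → (∀ s′ → s ℕ.≤ s′ → s′ ℕ.< s ℕ.+ c → P (suc s′ , q)) → All P (lefts q s c)
  All-lefts q s zero P h = []
  All-lefts q s (suc c) P h = h s ℕP.≤-refl (ℕP.m<m+n s (s≤s z≤n)) ∷
    All-lefts q (suc s) c P (λ s′ s<s′ s′< → h s′ (ℕP.<⇒≤ s<s′) (subst (s′ ℕ.<_) (sym (ℕP.+-suc s c)) s′<))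

  All-rights : ∀ q s c (P : TwoSubset → Set) → (∀ s′ → s ℕ.≤ s′ → s′ ℕ.< s ℕ.+ c → P (q , suc s′)) → All P (rights q s c)
  All-rights q s zero P h = []
  All-rights q s (suc c) P h = h s ℕP.≤-refl (ℕP.m<m+n s (s≤s z≤n)) ∷
    All-rights q (suc s) c P (λ s′ s<s′ s′< → h s′ (ℕP.<⇒≤ s<s′) (subst (s′ ℕ.<_) (sym (ℕP.+-suc s c)) s′<))

  length-lefts : ∀ q s c → length (lefts q s c) ≡ c
  length-lefts q s zero = refl
  length-lefts q s (suc c) = cong suc (length-lefts q (suc s) c)

  length-rights : ∀ q s c → length (rights q s c) ≡ c
  length-rights q s zero = refl
  length-rights q s (suc c) = cong suc (length-rights q (suc s) c)

  private
    weightedSum₃ : ∀ c₁ c₂ c₃ {x₁ x₂ x₃} β₁ β₂ β₃ → x₁ ≡ β₁ → x₂ ≡ β₂ → x₃ ≡ β₃ →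
      weightedSum (c₁ ∷ c₂ ∷ c₃ ∷ []) (x₁ ∷ x₂ ∷ x₃ ∷ []) ≡ c₁ * β₁ + (c₂ * β₂ + (c₃ * β₃ + 0ℚ))
    weightedSum₃ c₁ c₂ c₃ β₁ β₂ β₃ refl refl refl = refl

    pairwise-sums≡0 : ∀ a b c → a + b ≡ 0ℚ → a + c ≡ 0ℚ → b + c ≡ 0ℚ → All (_≡ 0ℚ) (a ∷ b ∷ c ∷ [])
    pairwise-sums≡0 a b c a+b≡0 a+c≡0 b+c≡0 = a≡0 ∷ b≡0 ∷ c≡0 ∷ []
      where
      a≡0 : a ≡ 0ℚ
      a≡0 = trans (solve 3 (λ a b c → a := con ½ :* ((a :+ b) :+ (a :+ c) :+ :- (b :+ c))) refl a b c)
        (trans (cong₂ (λ x y → ½ * (x + y + - (b + c))) a+b≡0 a+c≡0) (cong (λ z → ½ * (0ℚ + 0ℚ + - z)) b+c≡0))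
      b≡0 : b ≡ 0ℚ
      b≡0 = trans (sym (+-identityˡ b)) (trans (cong (_+ b) (sym a≡0)) a+b≡0)
      c≡0 : c ≡ 0ℚ
      c≡0 = trans (sym (+-identityˡ c)) (trans (cong (_+ c) (sym a≡0)) a+c≡0)

  -- Reading the relation at the coordinates r+1, r+2, r+3 gives c₁+c₂ = c₁+c₃ = c₂+c₃ = 0.
  triangle-independent : ∀ n r → 3 ℕ.+ r ℕ.≤ n → LinearlyIndependent (map (indicator n) (triangle r))
  triangle-independent n r 3+r≤n (c₁ ∷ c₂ ∷ c₃ ∷ []) _ e = pairwise-sums≡0 c₁ c₂ c₃
    (at j₁ 1ℚ 1ℚ 0ℚ (lookup-indicator-fst j₁ _ (2 ℕ.+ r) t₁) (lookup-indicator-fst j₁ _ (3 ℕ.+ r) t₁)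
        (lookup-indicator-≢ j₁ (2 ℕ.+ r) (3 ℕ.+ r) (λ e → <⇒≢ ℕP.≤-refl (trans (sym t₁) e)) (λ e → <⇒≢ (ℕP.n≤1+n _) (trans (sym t₁) e)))
        (solve 3 (λ a b c → a :* con 1ℚ :+ (b :* con 1ℚ :+ (c :* con 0ℚ :+ con 0ℚ)) := a :+ b) refl c₁ c₂ c₃))
    (at j₂ 1ℚ 0ℚ 1ℚ (lookup-indicator-snd j₂ (suc r) _ t₂)
        (lookup-indicator-≢ j₂ (suc r) (3 ℕ.+ r) (λ e → <⇒≢ ℕP.≤-refl (trans (sym e) t₂)) (λ e → <⇒≢ ℕP.≤-refl (trans (sym t₂) e)))
        (lookup-indicator-fst j₂ _ (3 ℕ.+ r) t₂)
        (solve 3 (λ a b c → a :* con 1ℚ :+ (b :* con 0ℚ :+ (c :* con 1ℚ :+ con 0ℚ)) := a :+ c) refl c₁ c₂ c₃))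
    (at j₃ 0ℚ 1ℚ 1ℚ
        (lookup-indicator-≢ j₃ (suc r) (2 ℕ.+ r) (λ e → <⇒≢ (ℕP.n≤1+n _) (trans (sym e) t₃)) (λ e → <⇒≢ ℕP.≤-refl (trans (sym e) t₃)))
        (lookup-indicator-snd j₃ (suc r) _ t₃) (lookup-indicator-snd j₃ (2 ℕ.+ r) _ t₃)
        (solve 3 (λ a b c → a :* con 0ℚ :+ (b :* con 1ℚ :+ (c :* con 1ℚ :+ con 0ℚ)) := b :+ c) refl c₁ c₂ c₃))
    where
    <⇒≢ = ℕP.<⇒≢
    j₁ = fromℕ< {r} (ℕP.≤-trans (ℕP.n≤1+n _) (ℕP.≤-trans (ℕP.n≤1+n _) 3+r≤n))
    j₂ = fromℕ< {suc r} (ℕP.≤-trans (ℕP.n≤1+n _) 3+r≤n)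
    j₃ = fromℕ< {2 ℕ.+ r} 3+r≤n
    t₁ : suc (toℕ j₁) ≡ suc r
    t₁ = cong suc (toℕ-fromℕ< _)
    t₂ : suc (toℕ j₂) ≡ 2 ℕ.+ r
    t₂ = cong suc (toℕ-fromℕ< _)
    t₃ : suc (toℕ j₃) ≡ 3 ℕ.+ r
    t₃ = cong suc (toℕ-fromℕ< _)
    at : ∀ j β₁ β₂ β₃ {s} → lookup (indicator n (suc r , 2 ℕ.+ r)) j ≡ β₁ → lookup (indicator n (suc r , 3 ℕ.+ r)) j ≡ β₂ →
      lookup (indicator n (2 ℕ.+ r , 3 ℕ.+ r)) j ≡ β₃ → c₁ * β₁ + (c₂ * β₂ + (c₃ * β₃ + 0ℚ)) ≡ s → s ≡ 0ℚ
    at j β₁ β₂ β₃ x₁ x₂ x₃ s≡ = trans (sym s≡) (trans (sym (weightedSum₃ c₁ c₂ c₃ β₁ β₂ β₃ x₁ x₂ x₃))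
      (lincomb≡0⁻ (c₁ ∷ c₂ ∷ c₃ ∷ []) (map (indicator n) (triangle r)) e j))

  -- n bases of M[{1,u},{q,n}], q = r + 2, whose indicator vectors are linearly independent:
  -- {i, q} for i ≤ r, {q, i} for i ≥ r + 4, and the triangle on r+1, r+2, r+3.
  module Family (n r : ℕ) (3+r≤n : 3 ℕ.+ r ℕ.≤ n) where

    q : ℕ
    q = 2 ℕ.+ r

    #rights : ℕ
    #rights = n ∸ (3 ℕ.+ r)

    upper : List TwoSubset
    upper = rights q (3 ℕ.+ r) #rights ++ triangle r

    family : List TwoSubset
    family = lefts q 0 r ++ upper

    private
      <⇒≢ = ℕP.<⇒≢

      >⇒≢ : ∀ {x y} → y ℕ.< x → x ≢ y
      >⇒≢ y<x x≡y = ℕP.<⇒≢ y<x (sym x≡y)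

      avoids-triangle-below : ∀ x → x ℕ.≤ r → Avoids x (triangle r)
      avoids-triangle-below x x≤r =
        (<⇒≢ (s≤s x≤r) , <⇒≢ (ℕP.m≤n⇒m≤1+n (s≤s x≤r))) ∷
        (<⇒≢ (s≤s x≤r) , <⇒≢ (ℕP.m≤n⇒m≤1+n (ℕP.m≤n⇒m≤1+n (s≤s x≤r)))) ∷
        (<⇒≢ (ℕP.m≤n⇒m≤1+n (s≤s x≤r)) , <⇒≢ (ℕP.m≤n⇒m≤1+n (ℕP.m≤n⇒m≤1+n (s≤s x≤r)))) ∷ []

      avoids-triangle-above : ∀ x → 4 ℕ.+ r ℕ.≤ x → Avoids x (triangle r)
      avoids-triangle-above x 4+r≤x =
        (>⇒≢ (ℕP.≤-trans (ℕP.n≤1+n _) (ℕP.≤-trans (ℕP.n≤1+n _) 4+r≤x)) , >⇒≢ (ℕP.≤-trans (ℕP.n≤1+n _) 4+r≤x)) ∷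
        (>⇒≢ (ℕP.≤-trans (ℕP.n≤1+n _) (ℕP.≤-trans (ℕP.n≤1+n _) 4+r≤x)) , >⇒≢ 4+r≤x) ∷
        (>⇒≢ (ℕP.≤-trans (ℕP.n≤1+n _) 4+r≤x) , >⇒≢ 4+r≤x) ∷ []

    chain-rights : ∀ s c → 3 ℕ.+ r ℕ.≤ s → s ℕ.+ c ℕ.≤ n → FreshChain n (rights q s c) (triangle r)
    chain-rights s zero _ _ = _
    chain-rights s (suc c) 3+r≤s s+c<n =
      (j , inj₂ j≡ , subst (λ x → Avoids x (rights q (suc s) c ++ triangle r)) (sym j≡) avoids)
      , chain-rights (suc s) c (ℕP.m≤n⇒m≤1+n 3+r≤s) (ℕP.≤-trans (ℕP.≤-reflexive (sym (ℕP.+-suc s c))) s+c<n)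
      where
      s<n : s ℕ.< n
      s<n = ℕP.<-≤-trans (ℕP.m<m+n s (s≤s z≤n)) s+c<n
      j = fromℕ< s<n
      j≡ : suc (toℕ j) ≡ suc s
      j≡ = cong suc (toℕ-fromℕ< s<n)
      avoids : Avoids (suc s) (rights q (suc s) c ++ triangle r)
      avoids = All.++⁺
        (All-rights q (suc s) c _ λ s′ s<s′ _ → >⇒≢ (s≤s (ℕP.≤-trans (ℕP.n≤1+n _) 3+r≤s)) , <⇒≢ (s≤s s<s′))
        (avoids-triangle-above (suc s) (s≤s 3+r≤s))

    chain-lefts : ∀ s c → s ℕ.+ c ℕ.≤ r → FreshChain n (lefts q s c) upper
    chain-lefts s zero _ = _
    chain-lefts s (suc c) s+c<r =
      (j , inj₁ j≡ , subst (λ x → Avoids x (lefts q (suc s) c ++ upper)) (sym j≡) avoids)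
      , chain-lefts (suc s) c (ℕP.≤-trans (ℕP.≤-reflexive (sym (ℕP.+-suc s c))) s+c<r)
      where
      s<r : s ℕ.< r
      s<r = ℕP.<-≤-trans (ℕP.m<m+n s (s≤s z≤n)) s+c<r
      s<n : s ℕ.< n
      s<n = ℕP.<-≤-trans s<r (ℕP.≤-trans (ℕP.n≤1+n r) (ℕP.≤-trans (ℕP.n≤1+n _) (ℕP.≤-trans (ℕP.n≤1+n _) 3+r≤n)))
      j = fromℕ< s<n
      j≡ : suc (toℕ j) ≡ suc s
      j≡ = cong suc (toℕ-fromℕ< s<n)
      1+s<q : suc s ℕ.< q
      1+s<q = s≤s (ℕP.m≤n⇒m≤1+n s<r)
      avoids : Avoids (suc s) (lefts q (suc s) c ++ upper)
      avoids = All.++⁺ (All-lefts q (suc s) c _ λ s′ s<s′ _ → <⇒≢ (s≤s s<s′) , <⇒≢ 1+s<q)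
        (All.++⁺ (All-rights q (3 ℕ.+ r) #rights _ λ s′ 3+r≤s′ _ → <⇒≢ 1+s<q , <⇒≢ (ℕP.<-trans 1+s<q (ℕP.≤-trans (ℕP.n≤1+n _) (s≤s 3+r≤s′))))
          (avoids-triangle-below (suc s) s<r))

    family-independent : LinearlyIndependent (map (indicator n) family)
    family-independent = independent-chain (lefts q 0 r) upper (chain-lefts 0 r ℕP.≤-refl)
      (independent-chain (rights q (3 ℕ.+ r) #rights) (triangle r)
        (chain-rights (3 ℕ.+ r) #rights ℕP.≤-refl (ℕP.≤-reflexive (ℕP.m+[n∸m]≡n 3+r≤n)))
        (triangle-independent n r 3+r≤n))

    length-family : length (map (indicator n) family) ≡ n
    length-family = begin
      length (map (indicator n) family)
        ≡⟨ length-map (indicator n) family ⟩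
      length family
        ≡⟨ length-++ (lefts q 0 r) ⟩
      length (lefts q 0 r) ℕ.+ length upper
        ≡⟨ cong (length (lefts q 0 r) ℕ.+_) (length-++ (rights q (3 ℕ.+ r) #rights)) ⟩
      length (lefts q 0 r) ℕ.+ (length (rights q (3 ℕ.+ r) #rights) ℕ.+ 3)
        ≡⟨ cong₂ (λ a b → a ℕ.+ (b ℕ.+ 3)) (length-lefts q 0 r) (length-rights q _ #rights) ⟩
      r ℕ.+ (#rights ℕ.+ 3)
        ≡⟨ rearrange ⟩
      (3 ℕ.+ r) ℕ.+ #rights
        ≡⟨ ℕP.m+[n∸m]≡n 3+r≤n ⟩
      n ∎
      where
      open ≡-Reasoning
      rearrange : r ℕ.+ (#rights ℕ.+ 3) ≡ (3 ℕ.+ r) ℕ.+ #rights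
      rearrange = trans (cong (r ℕ.+_) (ℕP.+-comm #rights 3)) (trans (sym (ℕP.+-assoc r 3 #rights)) (cong (ℕ._+ #rights) (ℕP.+-comm r 3)))

    module _ (u : ℕ) (u≤q : u ℕ.≤ q) where

      private
        q≤n : q ℕ.≤ n
        q≤n = ℕP.≤-trans (ℕP.n≤1+n _) 3+r≤n

      family-bases : All (λ B → IsBasis n u q (proj₁ B) (proj₂ B)) family
      family-bases = All.++⁺
        (All-lefts q 0 r _ λ s′ _ s′<r → isBasis (s≤s z≤n) (s≤s (ℕP.m≤n⇒m≤1+n s′<r)) q≤n u≤q (ℕP.m≤n⇒m≤1+n (ℕP.m≤n⇒m≤1+n s′<r)))
        (All.++⁺
          (All-rights q (3 ℕ.+ r) #rights _ λ s′ 3+r≤s′ s′< →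
            isBasis (s≤s z≤n) (s≤s (ℕP.≤-trans (ℕP.n≤1+n _) 3+r≤s′)) (subst (s′ ℕ.<_) (ℕP.m+[n∸m]≡n 3+r≤n) s′<)
              (ℕP.≤-trans u≤q (ℕP.≤-trans (ℕP.n≤1+n _) (ℕP.≤-trans (ℕP.n≤1+n _) (s≤s 3+r≤s′)))) ℕP.≤-refl)
          ( isBasis (s≤s z≤n) ℕP.≤-refl q≤n u≤q (ℕP.n≤1+n _)
          ∷ isBasis (s≤s z≤n) (ℕP.n≤1+n _) 3+r≤n (ℕP.≤-trans u≤q (ℕP.n≤1+n _)) (ℕP.n≤1+n _)
          ∷ isBasis (s≤s z≤n) ℕP.≤-refl 3+r≤n (ℕP.≤-trans u≤q (ℕP.n≤1+n _)) ℕP.≤-refl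
          ∷ []))

      family⊆vertices : map (indicator n) family ⊆ polytopeLPM n (1 , u) (q , n)
      family⊆vertices x∈ with ∈-map⁻ (indicator n) x∈
      ... | (a , b) , B∈ , refl = ∈-map⁺ (indicator n) (∈-bases⁺ (All.lookup family-bases B∈))

  -- Every vertex has coordinate sum 2, so an affine relation among vertices is a linear one.
  affine⇒linear : ∀ n u v (ps : List (Vec ℚ n)) → v ℕ.< n → ps ⊆ polytopeLPM n (1 , u) (v , n) →
    AffIndep ps → LinearlyIndependent ps
  affine⇒linear n u v ps v<n ps⊆ affIndep c |c| e = affIndep c |c| Σc≡0 e
    where
    total≡2 : ∀ {p} → p ∈ ps → prefixSumℚ n p ≡ 1ℚ + 1ℚ
    total≡2 p∈ with ∈-map⁻ (indicator n) (ps⊆ p∈)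
    ... | (a , b) , B∈ , refl with ∈-bases⁻ {n} {u} {v} {a , b} v<n B∈
    ... | isBasis 1≤a a<b b≤n _ _ = trans (prefixSumℚ-indicator n n 1≤a a<b ℕP.≤-refl)
            (cong fromℕ (cong₂ ℕ._+_ (reached-yes (ℕP.≤-trans (ℕP.<⇒≤ a<b) b≤n)) (reached-yes b≤n)))
    2Σc≡0 : (1ℚ + 1ℚ) * sumℚ c ≡ 0ℚ
    2Σc≡0 = trans (sym (weightedSum-const (1ℚ + 1ℚ) c (map (prefixSumℚ n) ps) (trans |c| (sym (length-map (prefixSumℚ n) ps)))
                      (All.map⁺ (All.tabulate total≡2))))
              (trans (sym (prefixSumℚ-lincomb n c ps)) (trans (cong (prefixSumℚ n) e) (prefixSumℚ-0 n)))
    Σc≡0 : sumℚ c ≡ 0ℚ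
    Σc≡0 = trans (solve 1 (λ s → s := con ½ :* ((con 1ℚ :+ con 1ℚ) :* s)) refl (sumℚ c)) (trans (cong (½ *_) 2Σc≡0) refl)

  dimension-LPM : ∀ n u r d → 3 ℕ.+ r ℕ.≤ n → u ℕ.≤ 2 ℕ.+ r →
    IsDim (polytopeLPM n (1 , u) (2 ℕ.+ r , n)) d → suc d ≡ n
  dimension-LPM n u r d 3+r≤n u≤q ((ps , ps⊆ , affIndep , |ps|) , maximal) = ℕP.≤-antisym
    (subst (ℕ._≤ n) |ps| (independent⇒length≤ n ps (affine⇒linear n u (2 ℕ.+ r) ps 3+r≤n ps⊆ affIndep)))
    (subst (ℕ._≤ suc d) length-family (maximal (map (indicator n) family) (family⊆vertices u u≤q)
      λ c |c| _ e → family-independent c |c| e))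
    where open Family n r 3+r≤n

module SchubertMatroids where

  open import Defs
  open LatticePointInequalities using (Ineqs)
  open LatticePoints using (inDilate⇔ineqs)
  open Counting using (length-inclusion-exclusion)
  open Dimension using (dimension-LPM)
  open import Data.Nat as ℕ using (ℕ; suc; _≤_; _<_; _∸_)
  import Data.Nat.Properties as ℕP
  open import Data.Integer using (ℤ; +_; _+_; _-_; _*_)
  import Data.Integer.Properties as ℤP
  open import Data.Nat.Combinatorics using (_C_)
  open import Data.Vec using (Vec)
  open import Data.Rational using (ℚ)
  open import Data.List using (List; []; _∷_; map; upTo)
  open import Data.List.Properties using (map-cong)
  open import Data.List.Membership.Propositional using (_∈_)
  open import Data.Product using (_×_; _,_)
  open import Function.Bundles using (_⇔_)
  open import Function.Construct.Composition using (_⇔-∘_)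
  open import Relation.Binary.PropositionalEquality
  open import Algebra.Properties.CommutativeSemigroup ℤP.+-commutativeSemigroup
    using () renaming (interchange to +-interchange)

  sumℤ-+ : ∀ (f g : ℕ → ℤ) xs → sumℤ (map f xs) + sumℤ (map g xs) ≡ sumℤ (map (λ j → f j + g j) xs)
  sumℤ-+ f g [] = refl
  sumℤ-+ f g (x ∷ xs) = trans (+-interchange (f x) (sumℤ (map f xs)) (g x) (sumℤ (map g xs)))
    (cong (λ s → f x + g x + s) (sumℤ-+ f g xs))

  hstar-+ : ∀ d (L₁ L₂ L₃ L₄ : ℕ → ℕ) → (∀ t → L₁ t ℕ.+ L₂ t ≡ L₃ t ℕ.+ L₄ t) → ∀ m →
    hstar d L₁ m + hstar d L₂ m ≡ hstar d L₃ m + hstar d L₄ m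
  hstar-+ d L₁ L₂ L₃ L₄ sums m = begin
    hstar d L₁ m + hstar d L₂ m                                ≡⟨ sumℤ-+ (term L₁) (term L₂) (upTo (suc m)) ⟩
    sumℤ (map (λ j → term L₁ j + term L₂ j) (upTo (suc m)))  ≡⟨ cong sumℤ (map-cong pointwise (upTo (suc m))) ⟩
    sumℤ (map (λ j → term L₃ j + term L₄ j) (upTo (suc m)))  ≡⟨ sym (sumℤ-+ (term L₃) (term L₄) (upTo (suc m))) ⟩
    hstar d L₃ m + hstar d L₄ m                                ∎
    where
    open ≡-Reasoning
    coefficient : ℕ → ℤ
    coefficient j = sign j * + (suc d C j)
    term : (ℕ → ℕ) → ℕ → ℤ
    term L j = coefficient j * + L (m ∸ j)
    pointwise : ∀ j → term L₁ j + term L₂ j ≡ term L₃ j + term L₄ j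
    pointwise j = begin
      term L₁ j + term L₂ j                            ≡⟨ sym (ℤP.*-distribˡ-+ (coefficient j) (+ L₁ (m ∸ j)) (+ L₂ (m ∸ j))) ⟩
      coefficient j * + (L₁ (m ∸ j) ℕ.+ L₂ (m ∸ j))   ≡⟨ cong (λ s → coefficient j * + s) (sums (m ∸ j)) ⟩
      coefficient j * + (L₃ (m ∸ j) ℕ.+ L₄ (m ∸ j))   ≡⟨ ℤP.*-distribˡ-+ (coefficient j) (+ L₃ (m ∸ j)) (+ L₄ (m ∸ j)) ⟩
      term L₃ j + term L₄ j                            ∎

  m∸[m∸n∸1]∸1≡n : ∀ {m n} → n < m → m ∸ (m ∸ n ∸ 1) ∸ 1 ≡ n
  m∸[m∸n∸1]∸1≡n {m} {n} n<m = begin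
    m ∸ (m ∸ n ∸ 1) ∸ 1    ≡⟨ cong (λ z → m ∸ z ∸ 1) (ℕP.∸-+-assoc m n 1) ⟩
    m ∸ (m ∸ (n ℕ.+ 1)) ∸ 1 ≡⟨ cong (_∸ 1) (ℕP.m∸[m∸n]≡n (subst (_≤ m) (ℕP.+-comm 1 n) n<m)) ⟩
    n ℕ.+ 1 ∸ 1             ≡⟨ ℕP.m+n∸n≡m n 1 ⟩
    n                       ∎
    where open ≡-Reasoning

  inDilate-Mn⇔ : ∀ n k ℓ → 1 ≤ k → k ≤ n → ℓ < n → ∀ t x →
    InDilate (Mn n k ℓ) t x ⇔ Ineqs n (n ∸ ℓ ∸ 1) (n ∸ k) t x
  inDilate-Mn⇔ n k ℓ 1≤k k≤n ℓ<n t x =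
    subst (λ u → InDilate (polytopeLPM n (1 , u) (n ∸ k , n)) t x ⇔ Ineqs n (n ∸ ℓ ∸ 1) (n ∸ k) t x) n∸ℓ≡
      (inDilate⇔ineqs n (n ∸ ℓ ∸ 1) (n ∸ k) (ℕP.≤-trans (ℕP.m∸n≤m _ 1) (ℕP.m∸n≤m n ℓ)) (ℕP.∸-monoʳ-< 1≤k k≤n) t x)
    where
    n∸ℓ≡ : suc (n ∸ ℓ ∸ 1) ≡ n ∸ ℓ
    n∸ℓ≡ = trans (ℕP.+-comm 1 _) (ℕP.m∸n+n≡m (ℕP.m<n⇒0<n∸m ℓ<n))

  dimension-Mn : ∀ n k ℓ d → 1 ≤ k → k ≤ ℓ → 2 ℕ.+ k ≤ n → IsDim (Mn n k ℓ) d → suc d ≡ n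
  dimension-Mn n k ℓ d 1≤k k≤ℓ 2+k≤n dim = dimension-LPM n (n ∸ ℓ) r d 3+r≤n (subst (n ∸ ℓ ≤_) n∸k≡ (ℕP.∸-monoʳ-≤ n k≤ℓ))
    (subst (λ q → IsDim (polytopeLPM n (1 , n ∸ ℓ) (q , n)) d) n∸k≡ dim)
    where
    r = n ∸ (2 ℕ.+ k)
    n≡ : n ≡ k ℕ.+ (2 ℕ.+ r)
    n≡ = trans (sym (ℕP.m+[n∸m]≡n 2+k≤n)) (trans (cong (ℕ._+ r) (ℕP.+-comm 2 k)) (ℕP.+-assoc k 2 r))
    n∸k≡ : n ∸ k ≡ 2 ℕ.+ r
    n∸k≡ = trans (cong (_∸ k) n≡) (ℕP.m+n∸m≡n k (2 ℕ.+ r))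
    3+r≤n : 3 ℕ.+ r ≤ n
    3+r≤n = subst (3 ℕ.+ r ≤_) (sym n≡) (ℕP.+-monoˡ-≤ (2 ℕ.+ r) 1≤k)

  ehrhart-Mn : ∀ N k ℓ → 1 ≤ k → k ≤ ℓ → 2 ℕ.+ ℓ ≤ N → ∀ {LM L₁ L₂ LU} →
    IsEhrhart (Mn N k ℓ) LM → IsEhrhart (Mn N 1 ℓ) L₁ → IsEhrhart (Mn N 1 (N ∸ k ∸ 1)) L₂ → IsEhrhart (U2 N) LU →
    ∀ t → LM t ℕ.+ LU t ≡ L₁ t ℕ.+ L₂ t
  ehrhart-Mn (suc n) k ℓ 1≤k k≤ℓ 2+ℓ≤N EM E₁ E₂ EU t =
    let xsM , uniqM , ∈M , |xsM| = EM t
        xs₁ , uniq₁ , ∈₁ , |xs₁| = E₁ t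
        xs₂ , uniq₂ , ∈₂ , |xs₂| = E₂ t
        xsU , uniqU , ∈U , |xsU| = EU t
    in trans (sym (cong₂ ℕ._+_ |xsM| |xsU|))
         (trans (length-inclusion-exclusion t xsU uniqU (∈U′ ∈U) (N ∸ ℓ ∸ 1) k xsM xs₁ xs₂
                   (ℕP.≤-trans (ℕP.m∸n≤m _ 1) (ℕP.∸-monoʳ-≤ N k≤ℓ)) (ℕP.<⇒≤ k<N) uniqM uniq₁ uniq₂ (∈M′ ∈M) (∈₁′ ∈₁) (∈₂′ ∈₂))
           (cong₂ ℕ._+_ |xs₁| |xs₂|))
    where
    N = suc n
    ℓ<N : ℓ < N
    ℓ<N = ℕP.<-≤-trans (ℕP.m<n+m ℓ (ℕ.s≤s ℕ.z≤n)) 2+ℓ≤N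
    k<N : k < N
    k<N = ℕP.≤-<-trans k≤ℓ ℓ<N
    Points : List (Vec ℚ N) → List (Vec ℤ N) → Set
    Points vs xs = ∀ x → (x ∈ xs) ⇔ InDilate vs t x
    ∈M′ : ∀ {xs} → Points (Mn N k ℓ) xs → ∀ x → (x ∈ xs) ⇔ Ineqs N (N ∸ ℓ ∸ 1) (N ∸ k) t x
    ∈M′ ∈M x = inDilate-Mn⇔ N k ℓ 1≤k (ℕP.<⇒≤ k<N) ℓ<N t x ⇔-∘ ∈M x
    ∈₁′ : ∀ {xs} → Points (Mn N 1 ℓ) xs → ∀ x → (x ∈ xs) ⇔ Ineqs N (N ∸ ℓ ∸ 1) n t x
    ∈₁′ ∈₁ x = inDilate-Mn⇔ N 1 ℓ ℕP.≤-refl (ℕ.s≤s ℕ.z≤n) ℓ<N t x ⇔-∘ ∈₁ x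
    ∈₂′ : ∀ {xs} → Points (Mn N 1 (N ∸ k ∸ 1)) xs → ∀ x → (x ∈ xs) ⇔ Ineqs N k n t x
    ∈₂′ {xs} ∈₂ x = subst (λ p → (x ∈ xs) ⇔ Ineqs N p n t x) (m∸[m∸n∸1]∸1≡n k<N)
      (inDilate-Mn⇔ N 1 (N ∸ k ∸ 1) ℕP.≤-refl (ℕ.s≤s ℕ.z≤n) (ℕ.s≤s (ℕP.∸-monoˡ-≤ 1 (ℕP.m∸n≤m N k))) t x ⇔-∘ ∈₂ x)
    ∈U′ : ∀ {xs} → Points (U2 N) xs → ∀ x → (x ∈ xs) ⇔ Ineqs N 1 n t x
    ∈U′ {xs} ∈U x = subst (λ p → (x ∈ xs) ⇔ Ineqs N p n t x) (m∸[m∸n∸1]∸1≡n (ℕP.≤-<-trans 1≤k k<N))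
      (inDilate-Mn⇔ N 1 (N ∸ 2) ℕP.≤-refl (ℕ.s≤s ℕ.z≤n) (ℕ.s≤s (ℕP.m∸n≤m n 1)) t x ⇔-∘ ∈U x)

  same-dimension : ∀ n k ℓ → 1 ≤ k → k ≤ ℓ → 2 ℕ.+ ℓ ≤ n → ∀ {dM d₁ d₂ dU} →
    IsDim (Mn n k ℓ) dM → IsDim (Mn n 1 ℓ) d₁ → IsDim (Mn n 1 (n ∸ k ∸ 1)) d₂ → IsDim (U2 n) dU →
    d₁ ≡ dM × d₂ ≡ dM × dU ≡ dM
  same-dimension n k ℓ 1≤k k≤ℓ 2+ℓ≤n {dM} DM D₁ D₂ DU =
      ℕP.suc-injective (trans (dimension-Mn n 1 ℓ _ ℕP.≤-refl (ℕP.≤-trans 1≤k k≤ℓ) 3≤n D₁) (sym n≡))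
    , ℕP.suc-injective (trans (dimension-Mn n 1 (n ∸ k ∸ 1) _ ℕP.≤-refl 1≤n∸k∸1 3≤n D₂) (sym n≡))
    , ℕP.suc-injective (trans (dimension-Mn n 1 (n ∸ 2) _ ℕP.≤-refl (ℕP.m+n≤o⇒m≤o∸n 1 3≤n) 3≤n DU) (sym n≡))
    where
    2+k≤n : 2 ℕ.+ k ≤ n
    2+k≤n = ℕP.≤-trans (ℕP.+-monoʳ-≤ 2 k≤ℓ) 2+ℓ≤n
    3≤n : 3 ≤ n
    3≤n = ℕP.≤-trans (ℕP.+-monoʳ-≤ 2 1≤k) 2+k≤n
    1≤n∸k∸1 : 1 ≤ n ∸ k ∸ 1
    1≤n∸k∸1 = subst (1 ≤_) (sym (ℕP.∸-+-assoc n k 1))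
      (ℕP.m+n≤o⇒m≤o∸n 1 (subst (_≤ n) (cong suc (ℕP.+-comm 1 k)) 2+k≤n))
    n≡ : suc dM ≡ n
    n≡ = dimension-Mn n k ℓ dM 1≤k k≤ℓ 2+k≤n DM

  +≡⇒≡- : ∀ {a b c} → a + b ≡ c → a ≡ c - b
  +≡⇒≡- {a} {b} refl = solve 2 (λ a b → a := (a :+ b) :- b) refl a b
    where open import Data.Integer.Solver using (module +-*-Solver)
          open +-*-Solver

  hstar-relation : ∀ {dM d₁ d₂ dU} LM L₁ L₂ LU → d₁ ≡ dM × d₂ ≡ dM × dU ≡ dM →
    (∀ t → LM t ℕ.+ LU t ≡ L₁ t ℕ.+ L₂ t) →
    ∀ m → hstar dM LM m ≡ (hstar d₁ L₁ m + hstar d₂ L₂ m) - hstar dU LU m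
  hstar-relation LM L₁ L₂ LU (refl , refl , refl) sums m = +≡⇒≡- (hstar-+ _ LM LU L₁ L₂ sums m)

  ≤∸2⇒2+≤ : ∀ {ℓ n} → 2 ≤ n → ℓ ≤ n ∸ 2 → 2 ℕ.+ ℓ ≤ n
  ≤∸2⇒2+≤ {ℓ} {n} 2≤n ℓ≤n∸2 = subst (_≤ n) (ℕP.+-comm ℓ 2) (ℕP.m≤o∸n⇒m+n≤o ℓ 2≤n ℓ≤n∸2)

open import Defs
open import Data.Nat as ℕ using (ℕ; _≤_; _∸_; s≤s; z≤n)
open import Data.Nat.Properties using (≤-trans)
open import Data.Integer using (ℤ; _+_; _-_)
open import Relation.Binary.PropositionalEquality using (_≡_)
open SchubertMatroids using (hstar-relation; same-dimension; ehrhart-Mn; ≤∸2⇒2+≤)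

theorem6p11 : (n k ℓ : ℕ) → 4 ≤ n → 1 ≤ k → k ≤ ℓ → ℓ ≤ n ∸ 2 →
    (dM d₁ d₂ dU : ℕ) (LM L₁ L₂ LU : ℕ → ℕ) →
    IsDim (Mn n k ℓ) dM → IsEhrhart (Mn n k ℓ) LM →
    IsDim (Mn n 1 ℓ) d₁ → IsEhrhart (Mn n 1 ℓ) L₁ →
    IsDim (Mn n 1 (n ∸ k ∸ 1)) d₂ → IsEhrhart (Mn n 1 (n ∸ k ∸ 1)) L₂ →
    IsDim (U2 n) dU → IsEhrhart (U2 n) LU →
    (m : ℕ) → hstar dM LM m ≡ (hstar d₁ L₁ m + hstar d₂ L₂ m) - hstar dU LU m
theorem6p11 n k ℓ 4≤n 1≤k k≤ℓ ℓ≤n∸2 dM d₁ d₂ dU LM L₁ L₂ LU DM EM D₁ E₁ D₂ E₂ DU EU =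
  hstar-relation LM L₁ L₂ LU
    (same-dimension n k ℓ 1≤k k≤ℓ 2+ℓ≤n DM D₁ D₂ DU)
    (ehrhart-Mn n k ℓ 1≤k k≤ℓ 2+ℓ≤n EM E₁ E₂ EU)
  where
  2+ℓ≤n : 2 ℕ.+ ℓ ≤ n
  2+ℓ≤n = ≤∸2⇒2+≤ (≤-trans (s≤s (s≤s z≤n)) 4≤n) ℓ≤n∸2
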